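{- Let $r\ge1$, $n=1$, let $m_1,\dots,m_r\ge1$ be integers, and let $D$ be the distance matrix of the graph $C(1;m_1,\dots,m_r)$. Then: (i) if $m_j=1$ for all $1\le j\le r$, then $\det D=(-1)^{r-1}2^{r}$; (ii) if some $m_j$ ($1\le j\le r$) is even, then $\det D=0$.
   Context: $C(n;m_1,\dots,m_r)$ is the undirected, unweighted graph consisting of a path $u_0-u_1-\cdots-u_n$ of length $n$ together with, for each $1\le j\le r$, a path $u_n-v_1^{(j)}-\cdots-v_{m_j}^{(j)}-u_0$ through $m_j$ new vertices; thus it consists of $r$ cycles of lengths $n+m_1+1,\dots,n+m_r+1$, any two of which intersect exactly in the common path. Its distance matrix is $[d(x,y)]$ with $d$ the usual shortest-path distance. -}

module Defs where

open import Data.Nat as ℕ using (ℕ; zero; suc; _+_; _≡ᵇ_)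
open import Data.Bool using (Bool; true; false; _∨_; _∧_; if_then_else_)
open import Data.List using (List; []; _∷_; _++_; upTo; map; foldr)
open import Data.Bool.ListAction using (any)
open import Data.Fin using (Fin; toℕ)
open import Data.Integer as ℤ using (ℤ; +_)
open import Data.Vec using (Vec; []; _∷_; lookup)
open import Data.Product using (_×_; _,_)

Matrix : ℕ → Set
Matrix n = Fin n → Fin n → ℤ

minor : ∀ {n} → Matrix (suc n) → Fin (suc n) → Matrix n
minor M j r c = M (Data.Fin.suc r) (Data.Fin.punchIn j c)

sgn : ℕ → ℤ
sgn zero = + 1
sgn (suc k) = ℤ.- sgn k

sumFin : ∀ n → (Fin n → ℤ) → ℤ
sumFin zero f = + 0
sumFin (suc n) f = f Data.Fin.zero ℤ.+ sumFin n (λ i → f (Data.Fin.suc i))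

det : ∀ {n} → Matrix n → ℤ
det {zero} M = + 1
det {suc n} M = sumFin (suc n) (λ j → sgn (toℕ j) ℤ.* (M Data.Fin.zero j ℤ.* det (minor M j)))

Graph : ℕ → Set
Graph N = Fin N → Fin N → Bool

allVerts : ∀ N → List (Fin N)
allVerts N = Data.List.allFin N

step : ∀ {N} → Graph N → (Fin N → Bool) → (Fin N → Bool)
step {N} G S y = S y ∨ any (λ z → S z ∧ G z y) (allVerts N)

within : ∀ {N} → Graph N → ℕ → Fin N → Fin N → Bool
within G zero x y = toℕ x ≡ᵇ toℕ y
within G (suc k) x = step G (within G k x)

search : ∀ {N} → Graph N → Fin N → Fin N → ℕ → ℕ → ℕ
search G x y k zero = k
search G x y k (suc fuel) =
  if within G k x y then k else search G x y (suc k) fuel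

-- For connected graphs this is
-- found among 0..N.  (Only connected graphs are used below.)
dist : ∀ {N} → Graph N → Fin N → Fin N → ℕ
dist {N} G x y = search G x y 0 N

distMatrix : ∀ {N} → Graph N → Matrix N
distMatrix G x y = + dist G x y

-- Vertex labels (natural numbers):
--   u_i  ↦ i                      (0 ≤ i ≤ n)
--   v_k^(j) ↦ n + 1 + (m₁+…+m_{j-1}) + (k-1)   (1 ≤ k ≤ m_j)
-- so the vertex set is {0, …, n + m₁ + … + m_r}.

sumℕ : ∀ {r} → Vec ℕ r → ℕ
sumℕ [] = 0
sumℕ (m ∷ ms) = m + sumℕ ms

Cverts : ℕ → ∀ {r} → Vec ℕ r → ℕ
Cverts n ms = suc n + sumℕ ms

-- edges of the path  u_n - w_0 - w_1 - … - w_{m-1} - u_0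
-- where w_k has label  off + k
earEdges : (n off m : ℕ) → List (ℕ × ℕ)
earEdges n off zero = (n , 0) ∷ []
earEdges n off (suc m) = (n , off) ∷ go off m
  where
  go : ℕ → ℕ → List (ℕ × ℕ)
  go w zero = (w , 0) ∷ []
  go w (suc k) = (w , suc w) ∷ go (suc w) k

pathEdges : ℕ → List (ℕ × ℕ)
pathEdges n = map (λ i → (i , suc i)) (upTo n)

allEarEdges : (n off : ℕ) → ∀ {r} → Vec ℕ r → List (ℕ × ℕ)
allEarEdges n off [] = []
allEarEdges n off (m ∷ ms) = earEdges n off m ++ allEarEdges n (off + m) ms

Cedges : ℕ → ∀ {r} → Vec ℕ r → List (ℕ × ℕ)
Cedges n ms = pathEdges n ++ allEarEdges n (suc n) ms

C : (n : ℕ) → ∀ {r} → (ms : Vec ℕ r) → Graph (Cverts n ms)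
C n ms x y = any (λ e → match e) (Cedges n ms)
  where
  match : ℕ × ℕ → Bool
  match (a , b) = ((toℕ x ≡ᵇ a) ∧ (toℕ y ≡ᵇ b)) ∨ ((toℕ x ≡ᵇ b) ∧ (toℕ y ≡ᵇ a))

-- A shortest
-- path runs through u₁, through u₀, or inside a common ear; this gives a closed formula δ for the
-- distance, confirmed by walks of length δ and by δ changing by at most one along every edge.
-- (i) If every mⱼ = 1 the graph is a book of r triangles on the edge u₀u₁.  After subtracting the
-- columns of u₁ and u₀ from the ear columns, two expansions along the first row leave −2I, so the
-- determinant is −(−2)ʳ = (−1)ʳ⁻¹2ʳ.
-- (ii) If mⱼ = 2g + 2, ear j closes a cycle of length 2g + 4 on which u₁, v_{g+2} and v_{g+1}, u₀
-- are antipodal pairs; then d(x, v_{g+2}) + d(x, u₁) = d(x, v_{g+1}) + d(x, u₀) for every vertex x,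
-- so four columns of the distance matrix are linearly dependent and its determinant vanishes.

module Submission where

open import Defs
open import Data.Nat using (ℕ; suc; _≥_; _∸_; _^_)
open import Data.Integer using (+_; _*_)
open import Data.Nat.Divisibility using (_∣_)
open import Data.Vec using (Vec)
open import Data.Vec.Relation.Unary.All using (All)
open import Data.Vec.Relation.Unary.Any using (Any)
open import Data.Product using (_×_; _,_)
open import Relation.Binary.PropositionalEquality using (_≡_)

module ShortestPaths where

  open import Data.Nat using (ℕ; zero; suc; _+_; _≤_; _<_; z≤n; s≤s)
  open import Data.Nat.Properties
  open import Data.Bool using (T; true; false)
  open import Data.Bool.Properties using (T-∨; T-∧)
  open import Data.List.Membership.Propositional using (lose)
  open import Data.List.Membership.Propositional.Properties using (∈-allFin)
  open import Data.List.Relation.Unary.Any using (satisfied)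
  open import Data.List.Relation.Unary.Any.Properties using (any⁺; any⁻)
  open import Data.Fin using (Fin; toℕ)
  open import Data.Fin.Properties using (toℕ-injective)
  open import Data.Product using (_,_)
  open import Data.Sum using (inj₁; inj₂)
  open import Function.Bundles using (Equivalence)
  open import Relation.Binary.PropositionalEquality
  open import Relation.Nullary using (contradiction)

  open Equivalence using (to; from)

  module _ {N : ℕ} (G : Graph N) where

    data Walk (x : Fin N) : Fin N → ℕ → Set where
      []  : Walk x x 0
      _▷_ : ∀ {y z k} → Walk x y k → T (G y z) → Walk x z (suc k)

    walk⇒within : ∀ {x y k} → Walk x y k → T (within G k x y)
    walk⇒within {x} [] = ≡⇒≡ᵇ (toℕ x) (toℕ x) refl
    walk⇒within (_▷_ {y} w e) = from T-∨ (inj₂ (any⁺ _ (lose (∈-allFin y) (from T-∧ (walk⇒within w , e)))))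

    Lipschitz : (Fin N → ℕ) → Set
    Lipschitz f = ∀ y z → T (G y z) → f z ≤ suc (f y)

    module _ {x : Fin N} {f : Fin N → ℕ} (fx≡0 : f x ≡ 0) (lip : Lipschitz f) where

      within⇒≤ : ∀ k y → T (within G k x y) → f y ≤ k
      within⇒≤ zero y w with toℕ-injective (≡ᵇ⇒≡ (toℕ x) (toℕ y) w)
      ... | refl = ≤-reflexive fx≡0
      within⇒≤ (suc k) y w with to T-∨ w
      ... | inj₁ w′ = m≤n⇒m≤1+n (within⇒≤ k y w′)
      ... | inj₂ step with satisfied (any⁻ _ (allVerts N) step)
      ... | z , wz with to T-∧ wz
      ... | w′ , e = ≤-trans (lip z y e) (s≤s (within⇒≤ k z w′))

      search≡ : ∀ y fuel k → k ≤ f y → f y < k + fuel → T (within G (f y) x y) →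
                search G x y k fuel ≡ f y
      search≡ y zero k k≤f f<k+0 _ = contradiction (≤-trans (≤-reflexive (+-identityʳ k)) k≤f) (<⇒≱ f<k+0)
      search≡ y (suc fuel) k k≤f f<k+fuel w with within G k x y in eq
      ... | true = ≤-antisym k≤f (within⇒≤ k y (subst T (sym eq) _))
      ... | false with m≤n⇒m<n∨m≡n k≤f
      ...   | inj₁ k<f = search≡ y fuel (suc k) k<f (subst (f y <_) (+-suc k fuel) f<k+fuel) w
      ...   | inj₂ refl = contradiction (subst T eq w) λ ()

      dist≡potential : ∀ y → f y < N → Walk x y (f y) → dist G x y ≡ f y
      dist≡potential y f<N w = search≡ y N 0 z≤n f<N (walk⇒within w)

open ShortestPaths

module EarModel where

  open import Data.Nat using (ℕ; zero; suc; _+_; _∸_; _⊓_; ∣_-_∣; _≤_; _<_; z≤n; s≤s)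
  open import Data.Nat.Properties hiding (_≟_)
  open import Data.Fin using (Fin; _≟_)
  open import Data.Vec using (Vec; lookup)
  open import Data.Product using (_×_; _,_; proj₁; proj₂)
  open import Relation.Binary.PropositionalEquality
  open import Relation.Nullary using (yes; no; contradiction)

  Near : ℕ → ℕ → Set
  Near a b = a ≤ suc b × b ≤ suc a

  near-sym : ∀ {a b} → Near a b → Near b a
  near-sym (a≤ , b≤) = b≤ , a≤

  near-suc : ∀ a → Near a (suc a)
  near-suc a = m≤n⇒m≤1+n (n≤1+n a) , ≤-refl

  near-+ : ∀ c {a b} → Near a b → Near (c + a) (c + b)
  near-+ c {a} {b} (a≤ , b≤) =
    ≤-trans (+-monoʳ-≤ c a≤) (≤-reflexive (+-suc c b)) , ≤-trans (+-monoʳ-≤ c b≤) (≤-reflexive (+-suc c a))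

  near-⊓ : ∀ {a b c d} → Near a b → Near c d → Near (a ⊓ c) (b ⊓ d)
  near-⊓ (a≤ , b≤) (c≤ , d≤) = ⊓-mono-≤ a≤ c≤ , ⊓-mono-≤ b≤ d≤

  near-∸suc : ∀ m t → Near (m ∸ t) (m ∸ suc t)
  near-∸suc zero    t       = subst₂ Near (sym (0∸n≡0 t)) (sym (0∸n≡0 (suc t))) (z≤n , z≤n)
  near-∸suc (suc m) zero    = near-sym (near-suc m)
  near-∸suc (suc m) (suc t) = near-∸suc m t

  near-suc∸ : ∀ m t → Near (suc m ∸ t) (m ∸ t)
  near-suc∸ m zero    = near-sym (near-suc m)
  near-suc∸ m (suc t) = near-∸suc m t

  near-∣-∣ : ∀ t s → Near ∣ t - s ∣ ∣ t - suc s ∣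
  near-∣-∣ zero    s       = near-suc s
  near-∣-∣ (suc t) zero    = subst (λ a → Near (suc t) a) (sym (∣-∣-identityʳ t)) (near-sym (near-suc t))
  near-∣-∣ (suc t) (suc s) = near-∣-∣ t s

  n≤1+∣n-1∣ : ∀ n → n ≤ suc ∣ n - 1 ∣
  n≤1+∣n-1∣ zero    = z≤n
  n≤1+∣n-1∣ (suc n) = s≤s (≤-reflexive (sym (∣-∣-identityʳ n)))

  1+m∸n≤1+∣n-m∣ : ∀ m n → suc m ∸ n ≤ suc ∣ n - m ∣
  1+m∸n≤1+∣n-m∣ m n =
    ≤-trans (proj₁ (near-suc∸ m n)) (s≤s (≤-trans (m∸n≤∣m-n∣ m n) (≤-reflexive (∣-∣-comm m n))))

  module _ {r : ℕ} (ms : Vec ℕ r) where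

    m : Fin r → ℕ
    m = lookup ms

    -- v j t is the t-th inner vertex of ear j when 1 ≤ t ≤ m j; other values of t are junk,
    -- excluded by IsVertex.
    data Vertex : Set where
      u₀ u₁ : Vertex
      v     : Fin r → ℕ → Vertex

    data IsVertex : Vertex → Set where
      u₀ : IsVertex u₀
      u₁ : IsVertex u₁
      v  : ∀ j i → i < m j → IsVertex (v j (suc i))

    -- Ear j lies on the cycle u₁, v j 1, …, v j (m j), u₀ of length m j + 2; d₁ and d₀ measure
    -- the distance to u₁ and to u₀ on it.
    d₁ d₀ : Vertex → ℕ
    d₁ u₀      = 1
    d₁ u₁      = 0
    d₁ (v j t) = t ⊓ (suc (suc (m j)) ∸ t)
    d₀ u₀      = 0
    d₀ u₁      = 1
    d₀ (v j t) = (suc (m j) ∸ t) ⊓ suc t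

    viaHubs : Vertex → Vertex → ℕ
    viaHubs x y = (d₁ x + d₁ y) ⊓ (d₀ x + d₀ y)

    -- A shortest path runs through u₁, through u₀, or inside a common ear.
    δ : Vertex → Vertex → ℕ
    δ (v j s) (v k t) with j ≟ k
    ... | yes _ = ∣ s - t ∣ ⊓ viaHubs (v j s) (v k t)
    ... | no _  = viaHubs (v j s) (v k t)
    δ x y = viaHubs x y

    d₁≤1+d₀ : ∀ x → d₁ x ≤ suc (d₀ x)
    d₁≤1+d₀ u₀      = ≤-refl
    d₁≤1+d₀ u₁      = z≤n
    d₁≤1+d₀ (v j t) = ⊓-glb (≤-trans (m⊓n≤n t _) (proj₁ (near-suc∸ (suc (m j)) t)))
                            (≤-trans (m⊓n≤m t _) (m≤n⇒m≤1+n (n≤1+n t)))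

    d₀≤1+d₁ : ∀ x → d₀ x ≤ suc (d₁ x)
    d₀≤1+d₁ u₀      = z≤n
    d₀≤1+d₁ u₁      = ≤-refl
    d₀≤1+d₁ (v j t) = ⊓-glb (m⊓n≤n _ (suc t)) (≤-trans (m⊓n≤m _ _) (proj₂ (near-suc∸ (suc (m j)) t)))

    viaHubs-u₁ : ∀ x → viaHubs x u₁ ≡ d₁ x
    viaHubs-u₁ x rewrite +-identityʳ (d₁ x) | +-comm (d₀ x) 1 = m≤n⇒m⊓n≡m (d₁≤1+d₀ x)

    viaHubs-u₀ : ∀ x → viaHubs x u₀ ≡ d₀ x
    viaHubs-u₀ x rewrite +-identityʳ (d₀ x) | +-comm (d₁ x) 1 = m≥n⇒m⊓n≡n (d₀≤1+d₁ x)

    viaHubs≤d₁ : ∀ x y → viaHubs x y ≤ d₁ x + d₁ y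
    viaHubs≤d₁ x y = m⊓n≤m _ _

    viaHubs≤d₀ : ∀ x y → viaHubs x y ≤ d₀ x + d₀ y
    viaHubs≤d₀ x y = m⊓n≤n _ _

    δ-sameEar : ∀ j s t → δ (v j s) (v j t) ≡ ∣ s - t ∣ ⊓ viaHubs (v j s) (v j t)
    δ-sameEar j s t with j ≟ j
    ... | yes _ = refl
    ... | no j≢j = contradiction refl j≢j

    δ-otherEar : ∀ {j k} s t → j ≢ k → δ (v j s) (v k t) ≡ viaHubs (v j s) (v k t)
    δ-otherEar {j} {k} s t j≢k with j ≟ k
    ... | yes j≡k = contradiction j≡k j≢k
    ... | no _    = refl

    δ-self : ∀ x → δ x x ≡ 0
    δ-self u₀      = refl
    δ-self u₁      = refl
    δ-self (v j s) rewrite δ-sameEar j s s | ∣n-n∣≡0 s = refl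

    δ≤viaHubs : ∀ x y → δ x y ≤ viaHubs x y
    δ≤viaHubs u₀      _       = ≤-refl
    δ≤viaHubs u₁      _       = ≤-refl
    δ≤viaHubs (v _ _) u₀      = ≤-refl
    δ≤viaHubs (v _ _) u₁      = ≤-refl
    δ≤viaHubs (v j s) (v k t) with j ≟ k
    ... | yes _ = m⊓n≤n _ _
    ... | no _  = ≤-refl

    viaHubs-comm : ∀ x y → viaHubs x y ≡ viaHubs y x
    viaHubs-comm x y = cong₂ _⊓_ (+-comm (d₁ x) (d₁ y)) (+-comm (d₀ x) (d₀ y))

    data Edge : Vertex → Vertex → Set where
      hubs  : Edge u₀ u₁
      enter : ∀ j → Edge u₁ (v j 1)
      along : ∀ j t → Edge (v j (suc t)) (v j (suc (suc t)))
      leave : ∀ j → Edge (v j (m j)) u₀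

    near-d₁ : ∀ {y z} → Edge y z → Near (d₁ y) (d₁ z)
    near-d₁ hubs        = ≤-refl , z≤n
    near-d₁ (enter j)   = near-suc 0
    near-d₁ (along j t) = near-⊓ (near-suc (suc t)) (near-suc∸ (m j) t)
    near-d₁ (leave j)   = subst (λ a → Near (m j ⊓ a) 1) (sym (m+n∸n≡m 2 (m j))) (m⊓n≤n (m j) 2 , s≤s z≤n)

    near-d₀ : ∀ {y z} → Edge y z → Near (d₀ y) (d₀ z)
    near-d₀ hubs        = near-suc 0
    near-d₀ (enter j)   = s≤s z≤n , m⊓n≤n (m j) 2
    near-d₀ (along j t) = near-⊓ (near-∸suc (m j) t) (near-suc (suc (suc t)))
    near-d₀ (leave j)   = subst (λ a → Near (a ⊓ suc (m j)) 0) (sym (m+n∸n≡m 1 (m j))) (m⊓n≤m 1 (suc (m j)) , z≤n)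

    near-viaHubs : ∀ {y z} → Edge y z → ∀ x → Near (viaHubs x y) (viaHubs x z)
    near-viaHubs e x = near-⊓ (near-+ (d₁ x) (near-d₁ e)) (near-+ (d₀ x) (near-d₀ e))

    δ-near : ∀ {y z} → Edge y z → ∀ x → Near (δ x y) (δ x z)
    δ-near e u₀ = near-viaHubs e u₀
    δ-near e u₁ = near-viaHubs e u₁
    δ-near hubs (v i s) = near-viaHubs hubs (v i s)
    δ-near (along j t) (v i s) with i ≟ j
    ... | yes refl = near-⊓ (near-∣-∣ s (suc t)) (near-viaHubs (along j t) (v i s))
    ... | no _     = near-viaHubs (along j t) (v i s)
    δ-near (enter j) (v i s) with i ≟ j
    ... | no _     = near-viaHubs (enter j) (v i s)
    ... | yes refl =
      ⊓-glb (≤-trans (≤-reflexive (viaHubs-u₁ (v i s))) (≤-trans (m⊓n≤m s _) (n≤1+∣n-1∣ s))) (proj₁ near) ,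
      ≤-trans (m⊓n≤n ∣ s - 1 ∣ _) (proj₂ near)
      where near = near-viaHubs (enter j) (v i s)
    δ-near (leave j) (v i s) with i ≟ j
    ... | no _     = near-viaHubs (leave j) (v i s)
    ... | yes refl =
      ≤-trans (m⊓n≤n ∣ s - m i ∣ _) (proj₁ near) ,
      ⊓-glb (≤-trans (≤-reflexive (viaHubs-u₀ (v i s))) (≤-trans (m⊓n≤m _ (suc s)) (1+m∸n≤1+∣n-m∣ (m i) s)))
            (proj₂ near)
      where near = near-viaHubs (leave j) (v i s)

open EarModel

module Antipodal where

  open import Data.Nat using (ℕ; suc; _+_; _∸_; _⊓_; ∣_-_∣; _≤_; _<_; s≤s; s≤s⁻¹)
  open import Data.Nat.Properties hiding (_≟_)
  open import Data.Nat.Tactic.RingSolver using (solve-∀)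
  open import Data.Fin using (Fin; _≟_)
  open import Data.Vec using (Vec)
  open import Function using (_∘_)
  open import Relation.Binary.PropositionalEquality
  open import Relation.Nullary using (Dec; yes; no)

  ⊓-exchange : ∀ a b g → (a + suc (suc g)) ⊓ (b + suc g) + (a + 0) ⊓ (b + 1)
                       ≡ (a + suc g) ⊓ (b + suc (suc g)) + (a + 1) ⊓ (b + 0)
  ⊓-exchange a b g = begin
    (a + suc (suc g)) ⊓ (b + suc g) + (a + 0) ⊓ (b + 1)
      ≡⟨ cong₂ (λ p q → p ⊓ (b + suc g) + q ⊓ (b + 1)) (sym (+-assoc a 1 (suc g))) (+-identityʳ a) ⟩
    (a + 1 + suc g) ⊓ (b + suc g) + a ⊓ (b + 1)
      ≡⟨ cong (_+ a ⊓ (b + 1)) (sym (+-distribʳ-⊓ (suc g) (a + 1) b)) ⟩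
    ((a + 1) ⊓ b + suc g) + a ⊓ (b + 1)
      ≡⟨ swap ((a + 1) ⊓ b) (a ⊓ (b + 1)) (suc g) ⟩
    (a ⊓ (b + 1) + suc g) + (a + 1) ⊓ b
      ≡⟨ cong₂ _+_ (+-distribʳ-⊓ (suc g) a (b + 1)) (cong ((a + 1) ⊓_) (sym (+-identityʳ b))) ⟩
    (a + suc g) ⊓ (b + 1 + suc g) + (a + 1) ⊓ (b + 0)
      ≡⟨ cong (λ p → (a + suc g) ⊓ p + (a + 1) ⊓ (b + 0)) (+-assoc b 1 (suc g)) ⟩
    (a + suc g) ⊓ (b + suc (suc g)) + (a + 1) ⊓ (b + 0) ∎
    where
    open ≡-Reasoning
    swap : ∀ x y z → (x + z) + y ≡ (y + z) + x
    swap = solve-∀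

  ⊓-≡ˡ : ∀ a c {b} → b ≡ a + c → a ⊓ b ≡ a
  ⊓-≡ˡ a c refl = m≤n⇒m⊓n≡m (m≤m+n a c)

  ⊓-≡ʳ : ∀ b c {a} → a ≡ b + c → a ⊓ b ≡ b
  ⊓-≡ʳ b c refl = m≥n⇒m⊓n≡n (m≤m+n b c)

  ∸-≡ : ∀ a c {b} → b ≡ a + c → b ∸ a ≡ c
  ∸-≡ a c refl = m+n∸m≡n a c

  ∣-∣-≡ : ∀ a c {b} → b ≡ a + c → ∣ a - b ∣ ≡ c
  ∣-∣-≡ a c refl = ∣m-m+n∣≡n a c

  module _ {r : ℕ} (ms : Vec ℕ r) (j : Fin r) where

    private
      M = m ms j

    d₁-front : ∀ {g} d i → d + i ≡ g → M ≡ suc g + suc g → d₁ ms (v j (suc i)) ≡ suc i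
    d₁-front d i refl M≡ rewrite M≡ =
      trans (cong (suc i ⊓_) (∸-≡ i (suc i + (2 + (d + d))) (eq d i))) (⊓-≡ˡ (suc i) (2 + (d + d)) refl)
      where eq : ∀ d i → suc (suc (d + i) + suc (d + i)) ≡ i + (suc i + (2 + (d + d)))
            eq = solve-∀

    d₀-front : ∀ {g} d i → d + i ≡ g → M ≡ suc g + suc g → d₀ ms (v j (suc i)) ≡ suc (suc i)
    d₀-front d i refl M≡ rewrite M≡ =
      trans (cong (_⊓ suc (suc i)) (∸-≡ i (suc (suc i) + (d + d)) (eq d i))) (⊓-≡ʳ (suc (suc i)) (d + d) refl)
      where eq : ∀ d i → suc (d + i) + suc (d + i) ≡ i + (suc (suc i) + (d + d))
            eq = solve-∀

    d₁-back : ∀ {g} e f → e + f ≡ g → M ≡ suc g + suc g → d₁ ms (v j (suc (suc (e + g)))) ≡ suc (suc f)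
    d₁-back e f refl M≡ rewrite M≡ =
      trans (cong (suc (suc (e + (e + f))) ⊓_) (∸-≡ (e + (e + f)) (suc (suc f)) (eq₁ e f)))
            (⊓-≡ʳ (suc (suc f)) (e + e) (eq₂ e f))
      where eq₁ : ∀ e f → suc (e + f) + suc (e + f) ≡ e + (e + f) + suc (suc f)
            eq₁ = solve-∀
            eq₂ : ∀ e f → suc (suc (e + (e + f))) ≡ suc (suc f) + (e + e)
            eq₂ = solve-∀

    d₀-back : ∀ {g} e f → e + f ≡ g → M ≡ suc g + suc g → d₀ ms (v j (suc (suc (e + g)))) ≡ suc f
    d₀-back e f refl M≡ rewrite M≡ =
      trans (cong (_⊓ suc (suc (suc (e + (e + f))))) (∸-≡ (suc (e + (e + f))) (suc f) (eq₁ e f)))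
            (⊓-≡ˡ (suc f) (suc (suc (e + e))) (eq₂ e f))
      where eq₁ : ∀ e f → suc (e + f) + suc (e + f) ≡ suc (e + (e + f)) + suc f
            eq₁ = solve-∀
            eq₂ : ∀ e f → suc (suc (suc (e + (e + f)))) ≡ suc f + suc (suc (e + e))
            eq₂ = solve-∀

    δ-onEar : ∀ s t {a b c} → d₁ ms (v j t) ≡ a → d₀ ms (v j t) ≡ b →
              ∣ s - t ∣ ≡ c → c ≤ a → c ≤ b → δ ms (v j s) (v j t) ≡ c
    δ-onEar s t refl refl eq c≤a c≤b =
      trans (δ-sameEar ms j s t)
            (trans (cong (_⊓ viaHubs ms (v j s) (v j t)) eq)
                   (m≤n⇒m⊓n≡m (⊓-glb (≤-trans c≤a (m≤n+m _ _)) (≤-trans c≤b (m≤n+m _ _)))))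

    module _ {g : ℕ} (M≡ : M ≡ suc g + suc g) where

      d₁-v[g+2] : d₁ ms (v j (suc (suc g))) ≡ suc (suc g)
      d₁-v[g+2] = d₁-back 0 g refl M≡

      d₀-v[g+2] : d₀ ms (v j (suc (suc g))) ≡ suc g
      d₀-v[g+2] = d₀-back 0 g refl M≡

      d₁-v[g+1] : d₁ ms (v j (suc g)) ≡ suc g
      d₁-v[g+1] = d₁-front 0 g refl M≡

      d₀-v[g+1] : d₀ ms (v j (suc g)) ≡ suc (suc g)
      d₀-v[g+1] = d₀-front 0 g refl M≡

      viaHubs-antipodal : ∀ x → viaHubs ms x (v j (suc (suc g))) + viaHubs ms x u₁
                              ≡ viaHubs ms x (v j (suc g)) + viaHubs ms x u₀
      viaHubs-antipodal x rewrite d₁-v[g+2] | d₀-v[g+2] | d₁-v[g+1] | d₀-v[g+1] = ⊓-exchange (d₁ ms x) (d₀ ms x) g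

    Balanced : ℕ → Vertex ms → Set
    Balanced g x = δ ms x (v j (suc (suc g))) + δ ms x u₁ ≡ δ ms x (v j (suc g)) + δ ms x u₀

    -- x = v j s on ear j itself, with s ≤ g + 1 (front) or s ≥ g + 2 (back).
    balanced-front : ∀ {g} d i → d + i ≡ g → M ≡ suc g + suc g → Balanced g (v j (suc i))
    balanced-front d i refl M≡ = begin
      δ ms x (v j (suc (suc g))) + δ ms x u₁  ≡⟨ cong₂ _+_ δ-v[g+2] (trans (viaHubs-u₁ ms x) (d₁-front d i refl M≡)) ⟩
      suc d + suc i                           ≡⟨ sym (+-suc d (suc i)) ⟩
      d + suc (suc i)                         ≡⟨ sym (cong₂ _+_ δ-v[g+1] (trans (viaHubs-u₀ ms x) (d₀-front d i refl M≡))) ⟩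
      δ ms x (v j (suc g)) + δ ms x u₀        ∎
      where
      open ≡-Reasoning
      g = d + i
      x = v j (suc i)
      δ-v[g+2] : δ ms x (v j (suc (suc g))) ≡ suc d
      δ-v[g+2] = δ-onEar (suc i) (suc (suc g)) (d₁-v[g+2] M≡) (d₀-v[g+2] M≡) (∣-∣-≡ (suc i) (suc d) (eq d i))
                    (s≤s (m≤n⇒m≤1+n (m≤m+n d i))) (s≤s (m≤m+n d i))
        where eq : ∀ d i → suc (suc (d + i)) ≡ suc i + suc d
              eq = solve-∀
      δ-v[g+1] : δ ms x (v j (suc g)) ≡ d
      δ-v[g+1] = δ-onEar (suc i) (suc g) (d₁-v[g+1] M≡) (d₀-v[g+1] M≡) (∣-∣-≡ (suc i) d (cong suc (+-comm d i)))
                     (m≤n⇒m≤1+n (m≤m+n d i)) (m≤n⇒m≤1+n (m≤n⇒m≤1+n (m≤m+n d i)))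

    balanced-back : ∀ {g} e f → e + f ≡ g → M ≡ suc g + suc g → Balanced g (v j (suc (suc (e + g))))
    balanced-back e f refl M≡ = begin
      δ ms x (v j (suc (suc g))) + δ ms x u₁  ≡⟨ cong₂ _+_ δ-v[g+2] (trans (viaHubs-u₁ ms x) (d₁-back e f refl M≡)) ⟩
      e + suc (suc f)                         ≡⟨ +-suc e (suc f) ⟩
      suc e + suc f                           ≡⟨ sym (cong₂ _+_ δ-v[g+1] (trans (viaHubs-u₀ ms x) (d₀-back e f refl M≡))) ⟩
      δ ms x (v j (suc g)) + δ ms x u₀        ∎
      where
      open ≡-Reasoning
      g = e + f
      x = v j (suc (suc (e + g)))
      δ-v[g+2] : δ ms x (v j (suc (suc g))) ≡ e
      δ-v[g+2] = δ-onEar (suc (suc (e + g))) (suc (suc g)) (d₁-v[g+2] M≡) (d₀-v[g+2] M≡)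
                    (trans (∣-∣-comm (suc (suc (e + g))) (suc (suc g))) (∣-∣-≡ (suc (suc g)) e (cong (suc ∘ suc) (+-comm e g))))
                    (m≤n⇒m≤1+n (m≤n⇒m≤1+n (m≤m+n e f))) (m≤n⇒m≤1+n (m≤m+n e f))
      δ-v[g+1] : δ ms x (v j (suc g)) ≡ suc e
      δ-v[g+1] = δ-onEar (suc (suc (e + g))) (suc g) (d₁-v[g+1] M≡) (d₀-v[g+1] M≡)
                     (trans (∣-∣-comm (suc (suc (e + g))) (suc g)) (∣-∣-≡ (suc g) (suc e) (eq e g)))
                     (s≤s (m≤m+n e f)) (m≤n⇒m≤1+n (s≤s (m≤m+n e f)))
        where eq : ∀ e g → suc (suc (e + g)) ≡ suc g + suc e
              eq = solve-∀

    balanced : ∀ {g} → M ≡ suc g + suc g → ∀ {x} → IsVertex ms x → Balanced g x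
    balanced M≡ u₀ = viaHubs-antipodal M≡ u₀
    balanced M≡ u₁ = viaHubs-antipodal M≡ u₁
    balanced {g} M≡ (v i t t<) = byEar (i ≟ j)
      where
      byEar : Dec (i ≡ j) → Balanced g (v i (suc t))
      byEar (no i≢j) rewrite δ-otherEar ms (suc t) (suc (suc g)) i≢j | δ-otherEar ms (suc t) (suc g) i≢j =
        viaHubs-antipodal M≡ (v i (suc t))
      byEar (yes refl) with t ≤? g
      ... | yes t≤g = balanced-front (g ∸ t) t (m∸n+n≡m t≤g) M≡
      ... | no t≰g  = subst (λ t → Balanced g (v j (suc t))) e+1+g≡t (balanced-back e (g ∸ e) (m+[n∸m]≡n e≤g) M≡)
        where
        e = t ∸ suc g
        e+1+g≡t : suc (e + g) ≡ t
        e+1+g≡t = trans (sym (+-suc e g)) (m∸n+n≡m (≰⇒> t≰g))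
        e≤g : e ≤ g
        e≤g = s≤s⁻¹ (+-cancelʳ-< (suc g) e (suc g)
                (subst (_< suc g + suc g) (sym (m∸n+n≡m (≰⇒> t≰g))) (subst (t <_) M≡ t<)))

open Antipodal

module Labelling where

  open import Data.Nat using (ℕ; suc; _+_; _∸_; _≤_; _<_; s≤s⁻¹)
  open import Data.Nat.Properties hiding (_≟_)
  open import Data.Bool using (if_then_else_)
  open import Data.Fin using (Fin; zero; suc)
  open import Data.Vec using (Vec; []; _∷_)
  open import Data.Product using (Σ-syntax; _×_; _,_)
  open import Relation.Binary.PropositionalEquality
  open import Relation.Nullary using (does; yes; no)
  open import Relation.Nullary.Decidable using (dec-true; dec-false)

  offset : ∀ {r} → Vec ℕ r → Fin r → ℕ
  offset (_ ∷ _)  zero    = 0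
  offset (k ∷ ms) (suc j) = k + offset ms j

  label : ∀ {r} → Vec ℕ r → Fin r → ℕ → ℕ
  label ms j i = 2 + (offset ms j + i)

  shift : ∀ {r k} {ms : Vec ℕ r} → Vertex ms → Vertex (k ∷ ms)
  shift u₀      = u₀
  shift u₁      = u₁
  shift (v j t) = v (suc j) t

  earVertex : ∀ {r} (ms : Vec ℕ r) → ℕ → Vertex ms
  earVertex []       _ = u₀
  earVertex (k ∷ ms) ℓ = if does (ℓ <? k) then v zero (suc ℓ) else shift (earVertex ms (ℓ ∸ k))

  vertexOf : ∀ {r} (ms : Vec ℕ r) → ℕ → Vertex ms
  vertexOf ms 0             = u₀
  vertexOf ms 1             = u₁
  vertexOf ms (suc (suc ℓ)) = earVertex ms ℓ

  vertexOf-label : ∀ {r} (ms : Vec ℕ r) j i → i < m ms j → vertexOf ms (label ms j i) ≡ v j (suc i)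
  vertexOf-label (k ∷ ms) zero    i i<k rewrite dec-true (i <? k) i<k = refl
  vertexOf-label (k ∷ ms) (suc j) i i<m
    rewrite +-assoc k (offset ms j) i | dec-false (k + (offset ms j + i) <? k) (m+n≮m k _)
          | m+n∸m≡n k (offset ms j + i) | vertexOf-label ms j i i<m = refl

  offset+m≤sum : ∀ {r} (ms : Vec ℕ r) j → offset ms j + m ms j ≤ sumℕ ms
  offset+m≤sum (k ∷ ms) zero    = m≤m+n k (sumℕ ms)
  offset+m≤sum (k ∷ ms) (suc j) rewrite +-assoc k (offset ms j) (m ms j) = +-monoʳ-≤ k (offset+m≤sum ms j)

  earPosition : ∀ {r} (ms : Vec ℕ r) ℓ → ℓ < sumℕ ms → Σ[ j ∈ Fin r ] Σ[ i ∈ ℕ ] i < m ms j × ℓ ≡ offset ms j + i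
  earPosition (k ∷ ms) ℓ ℓ< with ℓ <? k
  ... | yes ℓ<k = zero , ℓ , ℓ<k , refl
  ... | no ℓ≮k with earPosition ms (ℓ ∸ k) (+-cancelˡ-< k _ _ (subst (_< k + sumℕ ms) (sym (m+[n∸m]≡n (≮⇒≥ ℓ≮k))) ℓ<))
  ...   | j , i , i< , eq = suc j , i , i< , trans (sym k+[ℓ∸k]≡ℓ) (trans (cong (_+_ k) eq) (sym (+-assoc k (offset ms j) i)))
    where k+[ℓ∸k]≡ℓ = m+[n∸m]≡n (≮⇒≥ ℓ≮k)

  module _ {r : ℕ} (ms : Vec ℕ r) where

    data LabelOf : ℕ → Vertex ms → Set where
      u₀ : LabelOf 0 u₀
      u₁ : LabelOf 1 u₁
      v  : ∀ j i → i < m ms j → LabelOf (label ms j i) (v j (suc i))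

    labelOf : ∀ ℓ → ℓ < Cverts 1 ms → LabelOf ℓ (vertexOf ms ℓ)
    labelOf 0             _ = u₀
    labelOf 1             _ = u₁
    labelOf (suc (suc ℓ)) ℓ< with earPosition ms ℓ (s≤s⁻¹ (s≤s⁻¹ ℓ<))
    ... | j , i , i< , refl = subst (LabelOf (label ms j i)) (sym (vertexOf-label ms j i i<)) (v j i i<)

    isVertex : ∀ {ℓ x} → LabelOf ℓ x → IsVertex ms x
    isVertex u₀         = u₀
    isVertex u₁         = u₁
    isVertex (v j i i<) = v j i i<

    labelOf-unique : ∀ {a b x} → LabelOf a x → LabelOf b x → a ≡ b
    labelOf-unique u₀         u₀        = refl
    labelOf-unique u₁         u₁        = refl
    labelOf-unique (v j i _)  (v j i _) = refl

open Labelling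

module EdgeList where

  open import Data.Nat using (ℕ; zero; suc; _+_; _≤_; _<_; z≤n; s≤s; s≤s⁻¹)
  open import Data.Nat.Properties hiding (_≟_)
  open import Data.Fin using (Fin; zero; suc)
  open import Data.List using (List; []; _∷_; drop)
  open import Data.List.Membership.Propositional using (_∈_)
  open import Data.List.Membership.Propositional.Properties using (∈-++⁺ˡ; ∈-++⁺ʳ; ∈-++⁻)
  open import Data.List.Relation.Unary.Any using (here; there)
  open import Data.Vec using (Vec; []; _∷_)
  open import Data.Vec.Relation.Unary.All using (All; []; _∷_)
  open import Data.Product using (Σ-syntax; _×_; _,_)
  open import Data.Sum using (_⊎_; inj₁; inj₂)
  open import Relation.Binary.PropositionalEquality

  earTail : ℕ → ℕ → List (ℕ × ℕ)
  earTail w zero    = (w , 0) ∷ []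
  earTail w (suc k) = (w , suc w) ∷ earTail (suc w) k

  -- The local go of earEdges is out of reach, so it is compared with earTail through the ear that
  -- starts one label further on.
  earEdges-suc : ∀ n off k → earEdges n off (suc k) ≡ (n , off) ∷ earTail off k
  earEdges-suc n off zero    = refl
  earEdges-suc n off (suc k) = cong (λ es → (n , off) ∷ (off , suc off) ∷ drop 1 es) (earEdges-suc n (suc off) k)

  earTail-along : ∀ w k i → i < k → (w + i , w + suc i) ∈ earTail w k
  earTail-along w (suc k) zero    _         = here (cong₂ _,_ (+-identityʳ w) (+-comm w 1))
  earTail-along w (suc k) (suc i) (s≤s i<k) =
    there (subst₂ (λ a b → (a , b) ∈ earTail (suc w) k) (sym (+-suc w i)) (sym (+-suc w (suc i))) (earTail-along (suc w) k i i<k))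

  earTail-last : ∀ w k → (w + k , 0) ∈ earTail w k
  earTail-last w zero    = here (cong (_, 0) (+-identityʳ w))
  earTail-last w (suc k) = there (subst (λ a → (a , 0) ∈ earTail (suc w) k) (sym (+-suc w k)) (earTail-last (suc w) k))

  earTail-elim : ∀ w k {e} → e ∈ earTail w k → (Σ[ i ∈ ℕ ] i < k × e ≡ (w + i , w + suc i)) ⊎ e ≡ (w + k , 0)
  earTail-elim w zero    (here refl) = inj₂ (cong (_, 0) (sym (+-identityʳ w)))
  earTail-elim w (suc k) (here refl) = inj₁ (0 , s≤s z≤n , cong₂ _,_ (sym (+-identityʳ w)) (+-comm 1 w))
  earTail-elim w (suc k) (there e∈) with earTail-elim (suc w) k e∈
  ... | inj₁ (i , i<k , refl) = inj₁ (suc i , s≤s i<k , cong₂ _,_ (sym (+-suc w i)) (sym (+-suc w (suc i))))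
  ... | inj₂ refl             = inj₂ (cong (_, 0) (sym (+-suc w k)))

  labelFrom : ∀ {r} → Vec ℕ r → ℕ → Fin r → ℕ → ℕ
  labelFrom ms off j i = off + (offset ms j + i)

  labelFrom-shift : ∀ {r} k (ms : Vec ℕ r) off j i → labelFrom ms (off + k) j i ≡ labelFrom (k ∷ ms) off (suc j) i
  labelFrom-shift k ms off j i = trans (+-assoc off k _) (cong (_+_ off) (sym (+-assoc k (offset ms j) i)))

  -- Endpoints are fixed by equations, so that passing to a later ear only composes equations.
  data EarEdge {r} (ms : Vec ℕ r) (off : ℕ) : ℕ × ℕ → Set where
    enter : ∀ j {a} → a ≡ labelFrom ms off j 0 → EarEdge ms off (1 , a)
    along : ∀ j i {a b} → suc i < m ms j → a ≡ labelFrom ms off j i → b ≡ labelFrom ms off j (suc i) → EarEdge ms off (a , b)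
    leave : ∀ j i {a} → m ms j ≡ suc i → a ≡ labelFrom ms off j i → EarEdge ms off (a , 0)

  shiftEdge : ∀ {r k} {ms : Vec ℕ r} {off e} → EarEdge ms (off + k) e → EarEdge (k ∷ ms) off e
  shiftEdge {k = k} {ms} {off} (enter j a≡)         = enter (suc j) (trans a≡ (labelFrom-shift k ms off j 0))
  shiftEdge {k = k} {ms} {off} (along j i lt a≡ b≡) =
    along (suc j) i lt (trans a≡ (labelFrom-shift k ms off j i)) (trans b≡ (labelFrom-shift k ms off j (suc i)))
  shiftEdge {k = k} {ms} {off} (leave j i m≡ a≡)    = leave (suc j) i m≡ (trans a≡ (labelFrom-shift k ms off j i))

  earEdge-elim : ∀ {r} (ms : Vec ℕ r) → All (1 ≤_) ms → ∀ off {e} → e ∈ allEarEdges 1 off ms → EarEdge ms off e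
  earEdge-elim (suc k ∷ ms) (_ ∷ pos) off {e} e∈ with ∈-++⁻ (earEdges 1 off (suc k)) e∈
  ... | inj₂ e∈rest = shiftEdge (earEdge-elim ms pos (off + suc k) e∈rest)
  ... | inj₁ e∈ear with subst (e ∈_) (earEdges-suc 1 off k) e∈ear
  ...   | here refl = enter zero (sym (+-identityʳ off))
  ...   | there e∈tail with earTail-elim off k e∈tail
  ...     | inj₁ (i , i<k , refl) = along zero i (s≤s i<k) refl refl
  ...     | inj₂ refl             = leave zero k refl refl

  earEdge-intro : ∀ {r} (ms : Vec ℕ r) → All (1 ≤_) ms → ∀ off {e} → EarEdge ms off e → e ∈ allEarEdges 1 off ms
  earEdge-intro []           []        _   (enter () _)
  earEdge-intro []           []        _   (along () _ _ _ _)
  earEdge-intro []           []        _   (leave () _ _ _)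
  earEdge-intro (suc k ∷ ms) (_ ∷ pos) off e = intro e
    where
    first : ∀ {e} → e ∈ (1 , off) ∷ earTail off k → e ∈ allEarEdges 1 off (suc k ∷ ms)
    first {e} e∈ = ∈-++⁺ˡ (subst (e ∈_) (sym (earEdges-suc 1 off k)) e∈)
    later : ∀ {e} → EarEdge ms (off + suc k) e → e ∈ allEarEdges 1 off (suc k ∷ ms)
    later e = ∈-++⁺ʳ (earEdges 1 off (suc k)) (earEdge-intro ms pos (off + suc k) e)
    unshift : ∀ {j i} → labelFrom (suc k ∷ ms) off (suc j) i ≡ labelFrom ms (off + suc k) j i
    unshift {j} {i} = sym (labelFrom-shift (suc k) ms off j i)
    intro : ∀ {e} → EarEdge (suc k ∷ ms) off e → e ∈ allEarEdges 1 off (suc k ∷ ms)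
    intro (enter zero a≡)                       = first (here (cong (1 ,_) (trans a≡ (+-identityʳ off))))
    intro (along zero i lt refl refl)           = first (there (earTail-along off k i (s≤s⁻¹ lt)))
    intro (leave zero i refl refl)              = first (there (earTail-last off k))
    intro (enter (suc j) a≡)                    = later (enter j (trans a≡ unshift))
    intro (along (suc j) i lt a≡ b≡)            = later (along j i lt (trans a≡ unshift) (trans b≡ unshift))
    intro (leave (suc j) i m≡ a≡)               = later (leave j i m≡ (trans a≡ unshift))

open EdgeList

module DistanceFormula where

  open import Data.Nat using (ℕ; zero; suc; _+_; _∸_; _⊓_; ∣_-_∣; _≤_; _<_; _≡ᵇ_; z≤n; s≤s; s≤s⁻¹)
  open import Data.Nat.Properties hiding (_≟_)
  open import Data.Nat.Tactic.RingSolver using (solve-∀)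
  open import Data.Bool using (T; _∧_)
  open import Data.Bool.Properties using (T-∨; T-∧)
  open import Data.Fin using (Fin; toℕ; fromℕ<; _≟_)
  open import Data.Fin.Properties using (toℕ-injective; toℕ-fromℕ<; toℕ<n)
  open import Data.List.Membership.Propositional using (_∈_; lose; find)
  open import Data.List.Relation.Unary.Any using (here; there)
  open import Data.List.Relation.Unary.Any.Properties using (any⁺; any⁻)
  open import Data.Vec using (Vec)
  open import Data.Vec.Relation.Unary.All using (All)
  open import Data.Vec.Relation.Unary.All.Properties using () renaming (lookup⁺ to All-lookup)
  open import Data.Product using (_×_; _,_; proj₁; proj₂; swap)
  open import Data.Sum using (_⊎_; inj₁; inj₂; [_,_]′)
  import Data.Sum as Sum
  open import Function.Bundles using (Equivalence)
  open import Relation.Binary.PropositionalEquality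
  open import Relation.Nullary using (Dec; yes; no)
  open import Relation.Binary.Definitions using (tri<; tri≈; tri>)

  open Equivalence using (to; from)

  ≡ᵇ-pair : ∀ {p q a b} → T ((p ≡ᵇ a) ∧ (q ≡ᵇ b)) → (p , q) ≡ (a , b)
  ≡ᵇ-pair {p} {q} {a} {b} t with to T-∧ t
  ... | p≡a , q≡b = cong₂ _,_ (≡ᵇ⇒≡ p a p≡a) (≡ᵇ⇒≡ q b q≡b)

  ≡ᵇ-refl-pair : ∀ p q → T ((p ≡ᵇ p) ∧ (q ≡ᵇ q))
  ≡ᵇ-refl-pair p q = from T-∧ (≡⇒≡ᵇ p p refl , ≡⇒≡ᵇ q q refl)

  module _ {r : ℕ} (ms : Vec ℕ r) (pos : All (1 ≤_) ms) where

    N : ℕ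
    N = Cverts 1 ms

    Adjacent : ℕ → ℕ → Set
    Adjacent a b = (a , b) ∈ Cedges 1 ms ⊎ (b , a) ∈ Cedges 1 ms

    adjacent-sym : ∀ {a b} → Adjacent a b → Adjacent b a
    adjacent-sym = Sum.swap

    adjacent⇒edge : ∀ x y → Adjacent (toℕ x) (toℕ y) → T (C 1 ms x y)
    adjacent⇒edge x y (inj₁ xy∈) = any⁺ _ (lose xy∈ (from T-∨ (inj₁ (≡ᵇ-refl-pair (toℕ x) (toℕ y)))))
    adjacent⇒edge x y (inj₂ yx∈) = any⁺ _ (lose yx∈ (from T-∨ (inj₂ (≡ᵇ-refl-pair (toℕ x) (toℕ y)))))

    edge⇒adjacent : ∀ x y → T (C 1 ms x y) → Adjacent (toℕ x) (toℕ y)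
    edge⇒adjacent x y xy with find (any⁻ _ (Cedges 1 ms) xy)
    ... | (a , b) , e∈ , match with to (T-∨ {(toℕ x ≡ᵇ a) ∧ (toℕ y ≡ᵇ b)}) match
    ...   | inj₁ xy≡ab = inj₁ (subst (_∈ Cedges 1 ms) (sym (≡ᵇ-pair xy≡ab)) e∈)
    ...   | inj₂ yx≡ab = inj₂ (subst (_∈ Cedges 1 ms) (sym (cong swap (≡ᵇ-pair yx≡ab))) e∈)

    m≥1 : ∀ j → 1 ≤ m ms j
    m≥1 = All-lookup pos

    label<N : ∀ j i → i < m ms j → label ms j i < N
    label<N j i i< = s≤s (s≤s (<-≤-trans (+-monoʳ-< (offset ms j) i<) (offset+m≤sum ms j)))

    Cedge⇒Edge : ∀ {a b} → (a , b) ∈ Cedges 1 ms → Edge ms (vertexOf ms a) (vertexOf ms b)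
    Cedge⇒Edge (here refl) = hubs
    Cedge⇒Edge (there e∈) with earEdge-elim ms pos 2 e∈
    ... | enter j refl = subst (Edge ms u₁) (sym (vertexOf-label ms j 0 (m≥1 j))) (enter j)
    ... | along j i i+1< refl refl =
      subst₂ (Edge ms) (sym (vertexOf-label ms j i (<-trans (n<1+n i) i+1<))) (sym (vertexOf-label ms j (suc i) i+1<)) (along j i)
    ... | leave j i m≡ refl =
      subst (λ x → Edge ms x u₀) (sym (vertexOf-label ms j i (subst (i <_) (sym m≡) (n<1+n i))))
            (subst (λ t → Edge ms (v j t) u₀) m≡ (leave j))

    Cedge<N : ∀ {a b} → (a , b) ∈ Cedges 1 ms → a < N × b < N
    Cedge<N (here refl) = s≤s z≤n , s≤s (s≤s z≤n)
    Cedge<N (there e∈) with earEdge-elim ms pos 2 e∈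
    ... | enter j refl             = s≤s (s≤s z≤n) , label<N j 0 (m≥1 j)
    ... | along j i i+1< refl refl = label<N j i (<-trans (n<1+n i) i+1<) , label<N j (suc i) i+1<
    ... | leave j i m≡ refl        = label<N j i (subst (i <_) (sym m≡) (n<1+n i)) , s≤s z≤n

    δ-lipschitz : ∀ X → Lipschitz (C 1 ms) (λ w → δ ms X (vertexOf ms (toℕ w)))
    δ-lipschitz X y z yz with edge⇒adjacent y z yz
    ... | inj₁ yz∈ = proj₂ (δ-near ms (Cedge⇒Edge yz∈) X)
    ... | inj₂ zy∈ = proj₁ (δ-near ms (Cedge⇒Edge zy∈) X)

    data Trail : ℕ → ℕ → ℕ → Set where
      []  : ∀ {a} → Trail a a 0
      _▷_ : ∀ {a b c k} → Trail a b k → Adjacent b c → Trail a c (suc k)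

    _◁_ : ∀ {a b c k} → Adjacent a b → Trail b c k → Trail a c (suc k)
    e ◁ []       = [] ▷ e
    e ◁ (t ▷ e′) = (e ◁ t) ▷ e′

    _++_ : ∀ {a b c k l} → Trail a b k → Trail b c l → Trail a c (k + l)
    _++_ {k = k} t []                   = subst (Trail _ _) (sym (+-identityʳ k)) t
    _++_ {k = k} t (_▷_ {k = l} t′ e) = subst (Trail _ _) (sym (+-suc k l)) ((t ++ t′) ▷ e)

    reverse : ∀ {a b k} → Trail a b k → Trail b a k
    reverse []      = []
    reverse (t ▷ e) = adjacent-sym e ◁ reverse t

    shorter : ∀ {a b k l} → Trail a b k → Trail a b l → Trail a b (k ⊓ l)
    shorter {k = k} {l} t t′ with ⊓-sel k l
    ... | inj₁ k⊓l≡k = subst (Trail _ _) (sym k⊓l≡k) t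
    ... | inj₂ k⊓l≡l = subst (Trail _ _) (sym k⊓l≡l) t′

    trail⇒walk : ∀ {a b k} → Trail a b k → (x y : Fin N) → toℕ x ≡ a → toℕ y ≡ b → Walk (C 1 ms) x y k
    trail⇒walk [] x y refl y≡ with toℕ-injective y≡
    ... | refl = []
    trail⇒walk (_▷_ {b = b} t e) x y x≡ y≡ =
      trail⇒walk t x z x≡ (toℕ-fromℕ< b<N) ▷ adjacent⇒edge z y (subst₂ Adjacent (sym (toℕ-fromℕ< b<N)) (sym y≡) e)
      where
      b<N : b < N
      b<N = [ (λ e∈ → proj₁ (Cedge<N e∈)) , (λ e∈ → proj₂ (Cedge<N e∈)) ]′ e
      z = fromℕ< b<N

    hub-adjacent : Adjacent 0 1
    hub-adjacent = inj₁ (here refl)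

    enter-adjacent : ∀ j → Adjacent 1 (label ms j 0)
    enter-adjacent j = inj₁ (there (earEdge-intro ms pos 2 (enter j refl)))

    along-adjacent : ∀ j i → suc i < m ms j → Adjacent (label ms j i) (label ms j (suc i))
    along-adjacent j i lt = inj₁ (there (earEdge-intro ms pos 2 (along j i lt refl refl)))

    leave-adjacent : ∀ j i → m ms j ≡ suc i → Adjacent (label ms j i) 0
    leave-adjacent j i m≡ = inj₁ (there (earEdge-intro ms pos 2 (leave j i m≡ refl)))

    climb : ∀ j i d → i + d < m ms j → Trail (label ms j i) (label ms j (i + d)) d
    climb j i zero    _  = subst (λ t → Trail (label ms j i) (label ms j t) 0) (sym (+-identityʳ i)) []
    climb j i (suc d) lt =
      subst (λ t → Trail (label ms j i) (label ms j t) (suc d)) (sym (+-suc i d))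
        (climb j i d (<-trans (+-monoʳ-< i (n<1+n d)) lt) ▷ along-adjacent j (i + d) (subst (_< m ms j) (+-suc i d) lt))

    toU₁ : ∀ j i → i < m ms j → Trail (label ms j i) 1 (suc i)
    toU₁ j i i< = reverse (enter-adjacent j ◁ climb j 0 i i<)

    toU₀ : ∀ j i → i < m ms j → Trail (label ms j i) 0 (m ms j ∸ i)
    toU₀ j i i< with m ms j in m≡ | m≥1 j
    ... | suc k | _ = subst (Trail (label ms j i) 0) (sym (+-∸-assoc 1 i≤k)) (toEnd ▷ leave-adjacent j k m≡)
      where
      i≤k = s≤s⁻¹ i<
      toEnd : Trail (label ms j i) (label ms j k) (k ∸ i)
      toEnd = subst (λ t → Trail (label ms j i) (label ms j t) (k ∸ i)) (m+[n∸m]≡n i≤k)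
                (climb j i (k ∸ i) (subst (_< m ms j) (sym (m+[n∸m]≡n i≤k)) (subst (k <_) (sym m≡) (n<1+n k))))

    d₁-trail : ∀ {ℓ x} → LabelOf ms ℓ x → Trail ℓ 1 (d₁ ms x)
    d₁-trail u₀         = [] ▷ hub-adjacent
    d₁-trail u₁         = []
    d₁-trail (v j i i<) = shorter (toU₁ j i i<) (subst (Trail _ 1) (sym (+-∸-assoc 1 (<⇒≤ i<))) (toU₀ j i i< ▷ hub-adjacent))

    d₀-trail : ∀ {ℓ x} → LabelOf ms ℓ x → Trail ℓ 0 (d₀ ms x)
    d₀-trail u₀         = []
    d₀-trail u₁         = [] ▷ adjacent-sym hub-adjacent
    d₀-trail (v j i i<) = shorter (toU₀ j i i<) (toU₁ j i i< ▷ adjacent-sym hub-adjacent)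

    viaHubs-trail : ∀ {a b x y} → LabelOf ms a x → LabelOf ms b y → Trail a b (viaHubs ms x y)
    viaHubs-trail a b = shorter (d₁-trail a ++ reverse (d₁-trail b)) (d₀-trail a ++ reverse (d₀-trail b))

    sameEar-trail : ∀ j i i′ → i < m ms j → i′ < m ms j → Trail (label ms j i) (label ms j i′) ∣ i - i′ ∣
    sameEar-trail j i i′ i< i′< with ≤-total i i′
    ... | inj₁ i≤i′ = subst₂ (λ t d → Trail (label ms j i) (label ms j t) d) (m+[n∸m]≡n i≤i′)
                        (trans (sym (m≤n⇒∣n-m∣≡n∸m i≤i′)) (∣-∣-comm i′ i))
                        (climb j i (i′ ∸ i) (subst (_< m ms j) (sym (m+[n∸m]≡n i≤i′)) i′<))
    ... | inj₂ i′≤i = subst₂ (λ t d → Trail (label ms j t) (label ms j i′) d) (m+[n∸m]≡n i′≤i)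
                        (sym (m≤n⇒∣n-m∣≡n∸m i′≤i))
                        (reverse (climb j i′ (i ∸ i′) (subst (_< m ms j) (sym (m+[n∸m]≡n i′≤i)) i<)))

    δ-trail : ∀ {a b x y} → LabelOf ms a x → LabelOf ms b y → Trail a b (δ ms x y)
    δ-trail u₀ b = viaHubs-trail u₀ b
    δ-trail u₁ b = viaHubs-trail u₁ b
    δ-trail a@(v _ _ _) u₀ = viaHubs-trail a u₀
    δ-trail a@(v _ _ _) u₁ = viaHubs-trail a u₁
    δ-trail a@(v j i i<) b@(v j′ i′ i′<) = byEar (j ≟ j′)
      where
      byEar : Dec (j ≡ j′) → Trail (label ms j i) (label ms j′ i′) (δ ms (v j (suc i)) (v j′ (suc i′)))
      byEar (yes refl) = subst (Trail _ _) (sym (δ-sameEar ms j (suc i) (suc i′)))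
                               (shorter (sameEar-trail j i i′ i< i′<) (viaHubs-trail a b))
      byEar (no j≢j′)  = subst (Trail _ _) (sym (δ-otherEar ms (suc i) (suc i′) j≢j′)) (viaHubs-trail a b)

    d₁<label : ∀ {ℓ x} → LabelOf ms ℓ x → 1 ≤ ℓ → d₁ ms x < ℓ
    d₁<label u₁ _ = s≤s z≤n
    d₁<label (v j i _) _ = s≤s (≤-trans (m⊓n≤m (suc i) _) (s≤s (m≤n+m i (offset ms j))))

    d₀+label≤N : ∀ {ℓ x} → LabelOf ms ℓ x → d₀ ms x + ℓ ≤ N
    d₀+label≤N u₀ = z≤n
    d₀+label≤N u₁ = s≤s (s≤s z≤n)
    d₀+label≤N (v j i i<) = begin
      d₀ ms (v j (suc i)) + label ms j i        ≤⟨ +-monoˡ-≤ (label ms j i) (m⊓n≤m (m ms j ∸ i) _) ⟩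
      (m ms j ∸ i) + (2 + (offset ms j + i))    ≡⟨ rearrange (m ms j ∸ i) (offset ms j) i ⟩
      2 + (offset ms j + ((m ms j ∸ i) + i))    ≡⟨ cong (λ t → 2 + (offset ms j + t)) (m∸n+n≡m (<⇒≤ i<)) ⟩
      2 + (offset ms j + m ms j)                ≤⟨ s≤s (s≤s (offset+m≤sum ms j)) ⟩
      N                                         ∎
      where
      open ≤-Reasoning
      rearrange : ∀ d o i → d + (2 + (o + i)) ≡ 2 + (o + (d + i))
      rearrange = solve-∀

    -- d₁ x < label x and d₀ y ≤ N ∸ label y, so the route through the hubs is shorter than N
    -- whenever label x < label y.
    viaHubs<N⁺ : ∀ {a b x y} → LabelOf ms a x → LabelOf ms b y → 1 ≤ a → a < b → viaHubs ms x y < N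
    viaHubs<N⁺ {a} {b} {x} {y} ℓx ℓy 1≤a a<b = begin-strict
      viaHubs ms x y          ≤⟨ viaHubs≤d₁ ms x y ⟩
      d₁ ms x + d₁ ms y       ≤⟨ +-monoʳ-≤ (d₁ ms x) (d₁≤1+d₀ ms y) ⟩
      d₁ ms x + suc (d₀ ms y) ≡⟨ +-suc (d₁ ms x) (d₀ ms y) ⟩
      suc (d₁ ms x) + d₀ ms y ≤⟨ +-monoˡ-≤ (d₀ ms y) (d₁<label ℓx 1≤a) ⟩
      a + d₀ ms y             <⟨ +-monoˡ-< (d₀ ms y) a<b ⟩
      b + d₀ ms y             ≡⟨ +-comm b (d₀ ms y) ⟩
      d₀ ms y + b             ≤⟨ d₀+label≤N ℓy ⟩
      N                       ∎
      where open ≤-Reasoning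

    viaHubs<N : ∀ {a b x y} → LabelOf ms a x → LabelOf ms b y → a < b → viaHubs ms x y < N
    viaHubs<N {y = y} u₀ ℓy a<b = ≤-<-trans (viaHubs≤d₀ ms u₀ y) (<-≤-trans (m<m+n (d₀ ms y) a<b) (d₀+label≤N ℓy))
    viaHubs<N ℓx@u₁          ℓy a<b = viaHubs<N⁺ ℓx ℓy (s≤s z≤n) a<b
    viaHubs<N ℓx@(v _ _ _)   ℓy a<b = viaHubs<N⁺ ℓx ℓy (s≤s z≤n) a<b

    δ<N : ∀ a b → a < N → b < N → δ ms (vertexOf ms a) (vertexOf ms b) < N
    δ<N a b a<N b<N with <-cmp a b
    ... | tri< a<b _ _  = ≤-<-trans (δ≤viaHubs ms (vertexOf ms a) (vertexOf ms b))
                            (viaHubs<N (labelOf ms a a<N) (labelOf ms b b<N) a<b)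
    ... | tri≈ _ refl _ = subst (_< N) (sym (δ-self ms (vertexOf ms a))) (s≤s z≤n)
    ... | tri> _ _ b<a  = ≤-<-trans (δ≤viaHubs ms (vertexOf ms a) (vertexOf ms b))
                            (subst (_< N) (viaHubs-comm ms (vertexOf ms b) (vertexOf ms a))
                                   (viaHubs<N (labelOf ms b b<N) (labelOf ms a a<N) b<a))

    dist-C≡δ : ∀ x y → dist (C 1 ms) x y ≡ δ ms (vertexOf ms (toℕ x)) (vertexOf ms (toℕ y))
    dist-C≡δ x y = dist≡potential (C 1 ms) {x = x} (δ-self ms X) (δ-lipschitz X) y
                   (δ<N (toℕ x) (toℕ y) (toℕ<n x) (toℕ<n y))
                   (trail⇒walk (δ-trail (labelOf ms (toℕ x) (toℕ<n x)) (labelOf ms (toℕ y) (toℕ<n y))) x y refl refl)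
      where X = vertexOf ms (toℕ x)

open DistanceFormula

module Determinant where

  open import Data.Nat as ℕ using (ℕ; zero; suc; z≤n; s≤s)
  import Data.Nat.Properties as ℕ
  open import Data.Bool using (true; false; if_then_else_)
  open import Data.Integer as ℤ using (ℤ; +_; -[1+_]; _+_; _-_; _*_; -_)
  import Data.Integer.Properties as ℤ
  open import Data.Integer.Tactic.RingSolver using (solve-∀)
  open import Data.Fin using (Fin; toℕ; punchIn; punchOut; fromℕ<; _≟_) renaming (zero to fzero; suc to fsuc)
  open import Data.Fin.Properties
    using (suc-injective; toℕ-injective; toℕ-fromℕ<; toℕ<n; punchIn-injective; punchInᵢ≢i; punchIn-punchOut)
  open import Function using (_∘_)
  open import Relation.Binary.PropositionalEquality
  open import Relation.Binary.Definitions using (tri<; tri≈; tri>)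
  open import Data.Sum using (_⊎_; inj₁; inj₂; [_,_]′)
  open import Relation.Nullary using (does; yes; no; contradiction)
  open import Relation.Nullary.Decidable using (dec-true; dec-false)

  private
    variable
      n : ℕ

  sumFin-cong : ∀ n {f g : Fin n → ℤ} → (∀ i → f i ≡ g i) → sumFin n f ≡ sumFin n g
  sumFin-cong zero    _   = refl
  sumFin-cong (suc n) f≗g = cong₂ _+_ (f≗g fzero) (sumFin-cong n (f≗g ∘ fsuc))

  det-cong : {M M′ : Matrix n} → (∀ i k → M i k ≡ M′ i k) → det M ≡ det M′
  det-cong {zero}  _     = refl
  det-cong {suc n} M≗M′ =
    sumFin-cong (suc n) λ j →
      cong₂ (λ a d → sgn (toℕ j) * (a * d)) (M≗M′ fzero j) (det-cong (λ r k → M≗M′ (fsuc r) (punchIn j k)))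

  sumFin-linear : ∀ n a b (f g : Fin n → ℤ) → sumFin n (λ i → a * f i + b * g i) ≡ a * sumFin n f + b * sumFin n g
  sumFin-linear zero    a b f g = zeros a b
    where zeros : ∀ a b → + 0 ≡ a * + 0 + b * + 0
          zeros = solve-∀
  sumFin-linear (suc n) a b f g =
    trans (cong (_+_ (a * f fzero + b * g fzero)) (sumFin-linear n a b (f ∘ fsuc) (g ∘ fsuc)))
          (regroup a b (f fzero) (g fzero) (sumFin n (f ∘ fsuc)) (sumFin n (g ∘ fsuc)))
    where regroup : ∀ a b x y s t → a * x + b * y + (a * s + b * t) ≡ a * (x + s) + b * (y + t)
          regroup = solve-∀

  sumFin-single : ∀ n (f : Fin n → ℤ) j → (∀ k → k ≢ j → f k ≡ + 0) → sumFin n f ≡ f j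
  sumFin-single (suc n) f fzero    f≡0 =
    trans (cong (_+_ (f fzero)) (trans (sumFin-cong n (λ k → f≡0 (fsuc k) λ ())) (sumFin-zero n))) (ℤ.+-identityʳ (f fzero))
    where sumFin-zero : ∀ n → sumFin n (λ _ → + 0) ≡ + 0
          sumFin-zero zero    = refl
          sumFin-zero (suc n) = trans (ℤ.+-identityˡ _) (sumFin-zero n)
  sumFin-single (suc n) f (fsuc j) f≡0 =
    trans (cong (_+ sumFin n (f ∘ fsuc)) (f≡0 fzero λ ()))
          (trans (ℤ.+-identityˡ _) (sumFin-single n (f ∘ fsuc) j (λ k k≢j → f≡0 (fsuc k) (k≢j ∘ suc-injective))))

  laplaceTerm : Matrix (suc n) → Fin (suc n) → ℤ
  laplaceTerm M j = sgn (toℕ j) * (M fzero j * det (minor M j))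

  det-linear : (c : Fin n) (a b : ℤ) (M A B : Matrix n) →
    (∀ i → M i c ≡ a * A i c + b * B i c) →
    (∀ i k → k ≢ c → M i k ≡ A i k) → (∀ i k → k ≢ c → M i k ≡ B i k) →
    det M ≡ a * det A + b * det B
  det-linear {suc n} c a b M A B Mc MA MB =
    trans (sumFin-cong (suc n) term) (sumFin-linear (suc n) a b (laplaceTerm A) (laplaceTerm B))
    where
    term : ∀ j → laplaceTerm M j ≡ a * laplaceTerm A j + b * laplaceTerm B j
    term j with j ≟ c
    ... | yes refl = begin
      sgn (toℕ j) * (M fzero j * det (minor M j))
        ≡⟨ cong (λ x → sgn (toℕ j) * (x * det (minor M j))) (Mc fzero) ⟩
      sgn (toℕ j) * ((a * A fzero j + b * B fzero j) * det (minor M j))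
        ≡⟨ distrib (sgn (toℕ j)) a b (A fzero j) (B fzero j) (det (minor M j)) ⟩
      a * (sgn (toℕ j) * (A fzero j * det (minor M j))) + b * (sgn (toℕ j) * (B fzero j * det (minor M j)))
        ≡⟨ cong₂ (λ d d′ → a * (sgn (toℕ j) * (A fzero j * d)) + b * (sgn (toℕ j) * (B fzero j * d′)))
                 (minor-avoids A MA) (minor-avoids B MB) ⟩
      a * laplaceTerm A j + b * laplaceTerm B j ∎
      where
      open ≡-Reasoning
      distrib : ∀ s a b x y d → s * ((a * x + b * y) * d) ≡ a * (s * (x * d)) + b * (s * (y * d))
      distrib = solve-∀
      minor-avoids : ∀ X → (∀ i k → k ≢ j → M i k ≡ X i k) → det (minor M j) ≡ det (minor X j)
      minor-avoids X MX = det-cong (λ r k → MX (fsuc r) (punchIn j k) (punchInᵢ≢i j k))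
    ... | no j≢c = begin
      sgn (toℕ j) * (M fzero j * det (minor M j))
        ≡⟨ cong (λ d → sgn (toℕ j) * (M fzero j * d)) minor-linear ⟩
      sgn (toℕ j) * (M fzero j * (a * det (minor A j) + b * det (minor B j)))
        ≡⟨ distrib (sgn (toℕ j)) a b (M fzero j) (det (minor A j)) (det (minor B j)) ⟩
      a * (sgn (toℕ j) * (M fzero j * det (minor A j))) + b * (sgn (toℕ j) * (M fzero j * det (minor B j)))
        ≡⟨ cong₂ (λ x y → a * (sgn (toℕ j) * (x * det (minor A j))) + b * (sgn (toℕ j) * (y * det (minor B j))))
                 (MA fzero j j≢c) (MB fzero j j≢c) ⟩
      a * laplaceTerm A j + b * laplaceTerm B j ∎
      where
      open ≡-Reasoning
      distrib : ∀ s a b x d d′ → s * (x * (a * d + b * d′)) ≡ a * (s * (x * d)) + b * (s * (x * d′))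
      distrib = solve-∀
      c′ = punchOut j≢c
      avoids-c : ∀ k → k ≢ c′ → punchIn j k ≢ c
      avoids-c k k≢c′ eq = k≢c′ (punchIn-injective j k c′ (trans eq (sym (punchIn-punchOut j≢c))))
      minor-linear : det (minor M j) ≡ a * det (minor A j) + b * det (minor B j)
      minor-linear = det-linear c′ a b (minor M j) (minor A j) (minor B j)
        (λ r → subst (λ k → M (fsuc r) k ≡ a * A (fsuc r) k + b * B (fsuc r) k) (sym (punchIn-punchOut j≢c)) (Mc (fsuc r)))
        (λ r k k≢c′ → MA (fsuc r) (punchIn j k) (avoids-c k k≢c′))
        (λ r k k≢c′ → MB (fsuc r) (punchIn j k) (avoids-c k k≢c′))

  det-row₀ : (M : Matrix (suc n)) (j : Fin (suc n)) → (∀ k → k ≢ j → M fzero k ≡ + 0) → det M ≡ laplaceTerm M j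
  det-row₀ {n} M j row = sumFin-single (suc n) (laplaceTerm M) j vanish
    where
    vanish : ∀ k → k ≢ j → laplaceTerm M k ≡ + 0
    vanish k k≢j rewrite row k k≢j = ℤ.*-zeroʳ (sgn (toℕ k))

  det-diagonal : ∀ n (M : Matrix n) d → (∀ i → M i i ≡ d) → (∀ i k → i ≢ k → M i k ≡ + 0) → det M ≡ d ℤ.^ n
  det-diagonal zero    M d diag off = refl
  det-diagonal (suc n) M d diag off = begin
    det M                                      ≡⟨ det-row₀ M fzero (λ k k≢0 → off fzero k (k≢0 ∘ sym)) ⟩
    + 1 * (M fzero fzero * det (minor M fzero)) ≡⟨ ℤ.*-identityˡ _ ⟩
    M fzero fzero * det (minor M fzero)        ≡⟨ cong₂ _*_ (diag fzero) (det-diagonal n (minor M fzero) d (diag ∘ fsuc) off′) ⟩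
    d * d ℤ.^ n                                ∎
    where
    open ≡-Reasoning
    off′ : ∀ i k → i ≢ k → minor M fzero i k ≡ + 0
    off′ i k i≢k = off (fsuc i) (fsuc k) (i≢k ∘ suc-injective)

  transposeℕ : ℕ → ℕ → ℕ
  transposeℕ zero    zero          = 1
  transposeℕ zero    (suc zero)    = 0
  transposeℕ zero    (suc (suc t)) = suc (suc t)
  transposeℕ (suc c) zero          = zero
  transposeℕ (suc c) (suc t)       = suc (transposeℕ c t)

  punchInℕ : ℕ → ℕ → ℕ
  punchInℕ zero    t       = suc t
  punchInℕ (suc j) zero    = zero
  punchInℕ (suc j) (suc t) = suc (punchInℕ j t)

  toℕ-punchIn : ∀ (j : Fin (suc n)) k → toℕ (punchIn j k) ≡ punchInℕ (toℕ j) (toℕ k)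
  toℕ-punchIn fzero    k        = refl
  toℕ-punchIn (fsuc j) fzero    = refl
  toℕ-punchIn (fsuc j) (fsuc k) = cong suc (toℕ-punchIn j k)

  transposeℕ-c : ∀ c → transposeℕ c c ≡ suc c
  transposeℕ-c zero    = refl
  transposeℕ-c (suc c) = cong suc (transposeℕ-c c)

  transposeℕ-c+1 : ∀ c → transposeℕ c (suc c) ≡ c
  transposeℕ-c+1 zero    = refl
  transposeℕ-c+1 (suc c) = cong suc (transposeℕ-c+1 c)

  transposeℕ-involutive : ∀ c t → transposeℕ c (transposeℕ c t) ≡ t
  transposeℕ-involutive zero    zero          = refl
  transposeℕ-involutive zero    (suc zero)    = refl
  transposeℕ-involutive zero    (suc (suc t)) = refl
  transposeℕ-involutive (suc c) zero          = refl
  transposeℕ-involutive (suc c) (suc t)       = cong suc (transposeℕ-involutive c t)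

  transposeℕ-fix : ∀ c t → t ≢ c → t ≢ suc c → transposeℕ c t ≡ t
  transposeℕ-fix zero    zero          t≢0 _   = contradiction refl t≢0
  transposeℕ-fix zero    (suc zero)    _   t≢1 = contradiction refl t≢1
  transposeℕ-fix zero    (suc (suc t)) _   _   = refl
  transposeℕ-fix (suc c) zero          _   _   = refl
  transposeℕ-fix (suc c) (suc t)       t≢c t≢c+1 = cong suc (transposeℕ-fix c t (t≢c ∘ cong suc) (t≢c+1 ∘ cong suc))

  transposeℕ-< : ∀ {c t m} → suc c ℕ.< m → t ℕ.< m → transposeℕ c t ℕ.< m
  transposeℕ-< {zero}  {zero}        c+1<m _   = c+1<m
  transposeℕ-< {zero}  {suc zero}    _     t<m = ℕ.<-trans (s≤s z≤n) t<m
  transposeℕ-< {zero}  {suc (suc t)} _     t<m = t<m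
  transposeℕ-< {suc c} {zero}        _     t<m = t<m
  transposeℕ-< {suc c} {suc t} {suc m} c+1<m t<m = s≤s (transposeℕ-< (ℕ.s≤s⁻¹ c+1<m) (ℕ.s≤s⁻¹ t<m))

  punchInℕ-transposeℕ-above : ∀ c j t → suc (suc c) ℕ.≤ j → punchInℕ j (transposeℕ c t) ≡ transposeℕ c (punchInℕ j t)
  punchInℕ-transposeℕ-above zero    (suc zero)    _             (s≤s ())
  punchInℕ-transposeℕ-above zero    (suc (suc j)) zero          _ = refl
  punchInℕ-transposeℕ-above zero    (suc (suc j)) (suc zero)    _ = refl
  punchInℕ-transposeℕ-above zero    (suc (suc j)) (suc (suc t)) _ = refl
  punchInℕ-transposeℕ-above (suc c) (suc j)       zero          _ = refl
  punchInℕ-transposeℕ-above (suc c) (suc j)       (suc t)       c+2≤j = cong suc (punchInℕ-transposeℕ-above c j t (ℕ.s≤s⁻¹ c+2≤j))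

  punchInℕ-transposeℕ-below : ∀ c j t → j ℕ.< c → punchInℕ j (transposeℕ (ℕ.pred c) t) ≡ transposeℕ c (punchInℕ j t)
  punchInℕ-transposeℕ-below (suc c)       zero    t       _         = refl
  punchInℕ-transposeℕ-below (suc zero)    (suc j) _       (s≤s ())
  punchInℕ-transposeℕ-below (suc (suc c)) (suc j) zero    _         = refl
  punchInℕ-transposeℕ-below (suc (suc c)) (suc j) (suc t) (s≤s j<c) = cong suc (punchInℕ-transposeℕ-below (suc c) j t j<c)

  transposeℕ-punchInℕ : ∀ c t → transposeℕ c (punchInℕ c t) ≡ punchInℕ (suc c) t
  transposeℕ-punchInℕ zero    zero    = refl
  transposeℕ-punchInℕ zero    (suc t) = refl
  transposeℕ-punchInℕ (suc c) zero    = refl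
  transposeℕ-punchInℕ (suc c) (suc t) = cong suc (transposeℕ-punchInℕ c t)

  sumFin-transpose : ∀ n c (f g : Fin n → ℤ) → suc c ℕ.< n →
    (∀ j j′ → toℕ j′ ≡ transposeℕ c (toℕ j) → f j ≡ g j′) → sumFin n f ≡ sumFin n g
  sumFin-transpose (suc zero)    zero f g (s≤s ()) _
  sumFin-transpose (suc (suc n)) zero f g _ fg = begin
    f fzero + (f (fsuc fzero) + rest f)
      ≡⟨ cong₂ (λ x y → x + (y + rest f)) (fg fzero (fsuc fzero) refl) (fg (fsuc fzero) fzero refl) ⟩
    g (fsuc fzero) + (g fzero + rest f)
      ≡⟨ exchange (g (fsuc fzero)) (g fzero) (rest f) ⟩
    g fzero + (g (fsuc fzero) + rest f)
      ≡⟨ cong (λ s → g fzero + (g (fsuc fzero) + s)) (sumFin-cong n (λ i → fg (fsuc (fsuc i)) (fsuc (fsuc i)) refl)) ⟩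
    g fzero + (g (fsuc fzero) + rest g) ∎
    where
    open ≡-Reasoning
    rest : (Fin (suc (suc n)) → ℤ) → ℤ
    rest h = sumFin n (h ∘ fsuc ∘ fsuc)
    exchange : ∀ x y z → x + (y + z) ≡ y + (x + z)
    exchange = solve-∀
  sumFin-transpose (suc n) (suc c) f g c+1<n fg =
    cong₂ _+_ (fg fzero fzero refl)
              (sumFin-transpose n c (f ∘ fsuc) (g ∘ fsuc) (ℕ.s≤s⁻¹ c+1<n)
                                (λ j j′ eq → fg (fsuc j) (fsuc j′) (cong suc eq)))

  sumFin-neg : ∀ n (f : Fin n → ℤ) → sumFin n (-_ ∘ f) ≡ - sumFin n f
  sumFin-neg zero    f = refl
  sumFin-neg (suc n) f = trans (cong (_+_ (- f fzero)) (sumFin-neg n (f ∘ fsuc))) (sym (ℤ.neg-distrib-+ (f fzero) _))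

  sgn-adjacent : ∀ {a b} → b ≡ suc a ⊎ a ≡ suc b → ∀ y → sgn a * y ≡ - (sgn b * y)
  sgn-adjacent {a} (inj₁ refl) y = flip (sgn a) y
    where flip : ∀ s y → s * y ≡ - (- s * y)
          flip = solve-∀
  sgn-adjacent {b = b} (inj₂ refl) y = sym (ℤ.neg-distribˡ-* (sgn b) y)

  Swapped : Matrix n → Matrix n → ℕ → Set
  Swapped M M′ c = ∀ i k k′ → toℕ k′ ≡ transposeℕ c (toℕ k) → M′ i k ≡ M i k′

  swapped-minors : ∀ {M M′ : Matrix (suc n)} {c} → Swapped M M′ c → ∀ j j′ (τ : ℕ → ℕ) →
                   (∀ t → punchInℕ (toℕ j′) (τ t) ≡ transposeℕ c (punchInℕ (toℕ j) t)) →
                   ∀ r k k′ → toℕ k′ ≡ τ (toℕ k) → minor M′ j r k ≡ minor M j′ r k′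
  swapped-minors {c = c} swapped j j′ τ commute r k k′ k′≡ = swapped (fsuc r) (punchIn j k) (punchIn j′ k′) (begin
    toℕ (punchIn j′ k′)                ≡⟨ toℕ-punchIn j′ k′ ⟩
    punchInℕ (toℕ j′) (toℕ k′)              ≡⟨ cong (punchInℕ (toℕ j′)) k′≡ ⟩
    punchInℕ (toℕ j′) (τ (toℕ k))           ≡⟨ commute (toℕ k) ⟩
    transposeℕ c (punchInℕ (toℕ j) (toℕ k)) ≡⟨ cong (transposeℕ c) (sym (toℕ-punchIn j k)) ⟩
    transposeℕ c (toℕ (punchIn j k))   ∎)
    where open ≡-Reasoning

  SwapNegates : ℕ → Set
  SwapNegates n = ∀ {M M′ : Matrix n} c → suc c ℕ.< n → Swapped M M′ c → det M′ ≡ - det M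

  laplaceTerm-fixed : ∀ {M M′ : Matrix (suc n)} {c} → SwapNegates n → Swapped M M′ c → ∀ j c′ → suc c′ ℕ.< n →
    toℕ j ≡ transposeℕ c (toℕ j) → (∀ t → punchInℕ (toℕ j) (transposeℕ c′ t) ≡ transposeℕ c (punchInℕ (toℕ j) t)) →
    laplaceTerm M′ j ≡ - laplaceTerm M j
  laplaceTerm-fixed {M = M} {M′} swap-negates swapped j c′ c′+1<n j-fixed commute = begin
    sgn (toℕ j) * (M′ fzero j * det (minor M′ j))
      ≡⟨ cong₂ (λ x d → sgn (toℕ j) * (x * d)) (swapped fzero j j j-fixed)
               (swap-negates c′ c′+1<n (swapped-minors swapped j j (transposeℕ c′) commute)) ⟩
    sgn (toℕ j) * (M fzero j * - det (minor M j))
      ≡⟨ negate (sgn (toℕ j)) (M fzero j) (det (minor M j)) ⟩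
    - laplaceTerm M j ∎
    where
    open ≡-Reasoning
    negate : ∀ s x d → s * (x * - d) ≡ - (s * (x * d))
    negate = solve-∀

  laplaceTerm-exchanged : ∀ {M M′ : Matrix (suc n)} {c} → Swapped M M′ c →
    ∀ j j′ → toℕ j′ ≡ transposeℕ c (toℕ j) → toℕ j′ ≡ suc (toℕ j) ⊎ toℕ j ≡ suc (toℕ j′) →
    (∀ t → punchInℕ (toℕ j′) t ≡ transposeℕ c (punchInℕ (toℕ j) t)) → laplaceTerm M′ j ≡ - laplaceTerm M j′
  laplaceTerm-exchanged {M = M} {M′} swapped j j′ j′≡ adjacent commute = begin
    sgn (toℕ j) * (M′ fzero j * det (minor M′ j))
      ≡⟨ cong₂ (λ x d → sgn (toℕ j) * (x * d)) (swapped fzero j j′ j′≡) same-minor ⟩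
    sgn (toℕ j) * (M fzero j′ * det (minor M j′))
      ≡⟨ sgn-adjacent adjacent (M fzero j′ * det (minor M j′)) ⟩
    - laplaceTerm M j′ ∎
    where
    open ≡-Reasoning
    same-minor = det-cong (λ r k → swapped-minors swapped j j′ (λ t → t) commute r k k refl)

  -- Expanding along row 0, the terms of columns c and c + 1 trade places with a change of sign,
  -- and every other term changes sign by induction.
  laplaceTerm-swapped : ∀ {M M′ : Matrix (suc n)} {c} → SwapNegates n → suc c ℕ.< suc n → Swapped M M′ c →
    ∀ j j′ → toℕ j′ ≡ transposeℕ c (toℕ j) → laplaceTerm M′ j ≡ - laplaceTerm M j′
  laplaceTerm-swapped {n} {M} {M′} {c} swap-negates c+1<n swapped j j′ j′≡ with ℕ.<-cmp (toℕ j) c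
  ... | tri≈ _ j≡c _ = laplaceTerm-exchanged swapped j j′ j′≡ (inj₁ j′≡1+j) commute
    where
    j′≡1+j : toℕ j′ ≡ suc (toℕ j)
    j′≡1+j = trans j′≡ (trans (cong (transposeℕ c) j≡c) (trans (transposeℕ-c c) (cong suc (sym j≡c))))
    commute : ∀ t → punchInℕ (toℕ j′) t ≡ transposeℕ c (punchInℕ (toℕ j) t)
    commute t rewrite j′≡1+j | j≡c = sym (transposeℕ-punchInℕ c t)
  ... | tri< j<c _ _ = subst (λ j′ → laplaceTerm M′ j ≡ - laplaceTerm M j′) (sym j′≡j)
                         (laplaceTerm-fixed swap-negates swapped j (ℕ.pred c) c′+1<n (sym j-fixed)
                                            (λ t → punchInℕ-transposeℕ-below c (toℕ j) t j<c))
    where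
    j-fixed = transposeℕ-fix c (toℕ j) (ℕ.<⇒≢ j<c) (ℕ.<⇒≢ (ℕ.m<n⇒m<1+n j<c))
    j′≡j = toℕ-injective (trans j′≡ j-fixed)
    c′+1<n = subst (ℕ._< n) (sym (ℕ.suc-pred c {{ℕ.>-nonZero (ℕ.≤-<-trans z≤n j<c)}})) (ℕ.s≤s⁻¹ c+1<n)
  ... | tri> _ _ c<j with ℕ.m≤n⇒m<n∨m≡n c<j
  ...   | inj₂ 1+c≡j = laplaceTerm-exchanged swapped j j′ j′≡ (inj₂ j≡1+j′) commute
    where
    j′≡c : toℕ j′ ≡ c
    j′≡c = trans j′≡ (trans (cong (transposeℕ c) (sym 1+c≡j)) (transposeℕ-c+1 c))
    j≡1+j′ : toℕ j ≡ suc (toℕ j′)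
    j≡1+j′ = trans (sym 1+c≡j) (cong suc (sym j′≡c))
    commute : ∀ t → punchInℕ (toℕ j′) t ≡ transposeℕ c (punchInℕ (toℕ j) t)
    commute t rewrite j′≡c | sym 1+c≡j =
      sym (trans (cong (transposeℕ c) (sym (transposeℕ-punchInℕ c t))) (transposeℕ-involutive c (punchInℕ c t)))
  ...   | inj₁ 1+c<j = subst (λ j′ → laplaceTerm M′ j ≡ - laplaceTerm M j′) (sym j′≡j)
                         (laplaceTerm-fixed swap-negates swapped j c c+1<n′ (sym j-fixed)
                                            (λ t → punchInℕ-transposeℕ-above c (toℕ j) t 1+c<j))
    where
    j-fixed = transposeℕ-fix c (toℕ j) (ℕ.>⇒≢ c<j) (ℕ.>⇒≢ 1+c<j)
    j′≡j = toℕ-injective (trans j′≡ j-fixed)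
    c+1<n′ = ℕ.s≤s⁻¹ (ℕ.≤-<-trans 1+c<j (toℕ<n j))

  det-swap : ∀ n → SwapNegates n
  det-swap (suc n) {M} {M′} c c+1<n swapped =
    trans (sumFin-transpose (suc n) c (laplaceTerm M′) (-_ ∘ laplaceTerm M) c+1<n (laplaceTerm-swapped (det-swap n) c+1<n swapped))
          (sumFin-neg (suc n) (laplaceTerm M))

  swapColumns : (M : Matrix n) (c : ℕ) → suc c ℕ.< n → Matrix n
  swapColumns M c c+1<n i k = M i (fromℕ< (transposeℕ-< c+1<n (toℕ<n k)))

  swapColumns-swapped : ∀ (M : Matrix n) c c+1<n → Swapped M (swapColumns M c c+1<n) c
  swapColumns-swapped M c c+1<n i k k′ k′≡ = cong (M i) (toℕ-injective (trans (toℕ-fromℕ< _) (sym k′≡)))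

  x≡-x⇒x≡0 : ∀ x → x ≡ - x → x ≡ + 0
  x≡-x⇒x≡0 (+ zero)  _  = refl
  x≡-x⇒x≡0 (+ suc _) ()
  x≡-x⇒x≡0 -[1+ _ ]  ()

  gap : ∀ {a b} → a ℕ.< b → b ≡ suc ((b ℕ.∸ suc a) ℕ.+ a)
  gap {a} {b} a<b = trans (sym (ℕ.m∸n+n≡m a<b)) (ℕ.+-suc (b ℕ.∸ suc a) a)

  det-equal-columns-gap : ∀ g (M : Matrix n) (k k′ : Fin n) → toℕ k′ ≡ suc (g ℕ.+ toℕ k) →
                          (∀ i → M i k ≡ M i k′) → det M ≡ + 0
  det-equal-columns-gap {n} zero M k k′ k′≡ same =
    x≡-x⇒x≡0 (det M) (det-swap n (toℕ k) (subst (ℕ._< n) k′≡ (toℕ<n k′)) self-swapped)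
    where
    self-swapped : Swapped M M (toℕ k)
    self-swapped i a a′ a′≡ with toℕ a ℕ.≟ toℕ k | toℕ a ℕ.≟ suc (toℕ k)
    ... | yes a≡k | _ = trans (cong (M i) (toℕ-injective a≡k)) (trans (same i) (cong (M i) (toℕ-injective k′≡a′)))
      where k′≡a′ = trans k′≡ (sym (trans a′≡ (trans (cong (transposeℕ (toℕ k)) a≡k) (transposeℕ-c (toℕ k)))))
    ... | no _ | yes a≡k+1 =
      trans (cong (M i) (toℕ-injective (trans a≡k+1 (sym k′≡)))) (trans (sym (same i)) (cong (M i) (toℕ-injective k≡a′)))
      where k≡a′ = sym (trans a′≡ (trans (cong (transposeℕ (toℕ k)) a≡k+1) (transposeℕ-c+1 (toℕ k))))
    ... | no a≢k | no a≢k+1 = cong (M i) (toℕ-injective (sym (trans a′≡ (transposeℕ-fix (toℕ k) (toℕ a) a≢k a≢k+1))))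
  det-equal-columns-gap {n} (suc g) M k k′ k′≡ same =
    trans (sym (ℤ.neg-involutive (det M)))
          (cong -_ (trans (sym (det-swap n c c+1<n swapped)) (det-equal-columns-gap g M′ k kc (toℕ-fromℕ< c<n) same′)))
    where
    c = suc (g ℕ.+ toℕ k)
    c+1<n = subst (ℕ._< n) k′≡ (toℕ<n k′)
    c<n = ℕ.<-trans (ℕ.n<1+n c) c+1<n
    kc = fromℕ< c<n
    M′ = swapColumns M c c+1<n
    swapped = swapColumns-swapped M c c+1<n
    k<c : toℕ k ℕ.< c
    k<c = s≤s (ℕ.m≤n+m (toℕ k) g)
    transposed-kc : transposeℕ c (toℕ kc) ≡ suc c
    transposed-kc = trans (cong (transposeℕ c) (toℕ-fromℕ< c<n)) (transposeℕ-c c)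
    same′ : ∀ i → M′ i k ≡ M′ i kc
    same′ i = trans (swapped i k k (sym (transposeℕ-fix c (toℕ k) (ℕ.<⇒≢ k<c) (ℕ.<⇒≢ (ℕ.m<n⇒m<1+n k<c)))))
                (trans (same i) (sym (swapped i kc k′ (trans k′≡ (sym transposed-kc)))))

  det-equal-columns : ∀ (M : Matrix n) (k k′ : Fin n) → k ≢ k′ → (∀ i → M i k ≡ M i k′) → det M ≡ + 0
  det-equal-columns M k k′ k≢k′ same with ℕ.<-cmp (toℕ k) (toℕ k′)
  ... | tri< k<k′ _ _ = det-equal-columns-gap _ M k k′ (gap k<k′) same
  ... | tri≈ _ k≡k′ _ = contradiction (toℕ-injective k≡k′) k≢k′
  ... | tri> _ _ k′<k = det-equal-columns-gap _ M k′ k (gap k′<k) (sym ∘ same)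

  replaceColumn : Matrix n → Fin n → (Fin n → ℤ) → Matrix n
  replaceColumn M c u i k = if does (k ≟ c) then u i else M i k

  replaceColumn-at : ∀ (M : Matrix n) c u i → replaceColumn M c u i c ≡ u i
  replaceColumn-at M c u i rewrite dec-true (c ≟ c) refl = refl

  replaceColumn-off : ∀ (M : Matrix n) c u i k → k ≢ c → replaceColumn M c u i k ≡ M i k
  replaceColumn-off M c u i k k≢c rewrite dec-false (k ≟ c) k≢c = refl

  det-copy-column : ∀ (M : Matrix n) c k → c ≢ k → det (replaceColumn M c (λ i → M i k)) ≡ + 0
  det-copy-column M c k c≢k = det-equal-columns _ c k c≢k
    (λ i → trans (replaceColumn-at M c (λ i → M i k) i) (sym (replaceColumn-off M c (λ i → M i k) i k (c≢k ∘ sym))))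

  det-add-column : ∀ (M M′ : Matrix n) c k a → c ≢ k →
    (∀ i → M′ i c ≡ M i c + a * M i k) → (∀ i j → j ≢ c → M′ i j ≡ M i j) → det M′ ≡ det M
  det-add-column M M′ c k a c≢k M′c M′j = begin
    det M′                   ≡⟨ det-linear c (+ 1) a M′ M K col-c M′j other-columns ⟩
    + 1 * det M + a * det K  ≡⟨ cong (λ d → + 1 * det M + a * d) (det-copy-column M c k c≢k) ⟩
    + 1 * det M + a * + 0    ≡⟨ simplify (det M) a ⟩
    det M                    ∎
    where
    open ≡-Reasoning
    K = replaceColumn M c (λ i → M i k)
    col-c : ∀ i → M′ i c ≡ + 1 * M i c + a * K i c
    col-c i = trans (M′c i) (cong₂ (λ x y → x + a * y) (sym (ℤ.*-identityˡ (M i c))) (sym (replaceColumn-at M c (λ i → M i k) i)))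
    other-columns : ∀ i j → j ≢ c → M′ i j ≡ K i j
    other-columns i j j≢c = trans (M′j i j j≢c) (sym (replaceColumn-off M c (λ i → M i k) i j j≢c))
    simplify : ∀ d a → + 1 * d + a * + 0 ≡ d
    simplify = solve-∀

  det-replaceColumn : ∀ (M : Matrix n) c u → (∀ i → M i c ≡ u i) → det M ≡ det (replaceColumn M c u)
  det-replaceColumn M c u Mc≡u = det-cong entry
    where
    entry : ∀ i k → M i k ≡ replaceColumn M c u i k
    entry i k with k ≟ c
    ... | yes refl = Mc≡u i
    ... | no _     = refl

  det-replaceColumn-linear : ∀ (M : Matrix n) c a b u w →
    det (replaceColumn M c (λ i → a * u i + b * w i)) ≡ a * det (replaceColumn M c u) + b * det (replaceColumn M c w)
  det-replaceColumn-linear M c a b u w = det-linear c a b _ _ _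
    (λ i → trans (replaceColumn-at M c combination i)
                 (sym (cong₂ (λ x y → a * x + b * y) (replaceColumn-at M c u i) (replaceColumn-at M c w i))))
    (λ i k k≢c → trans (replaceColumn-off M c combination i k k≢c) (sym (replaceColumn-off M c u i k k≢c)))
    (λ i k k≢c → trans (replaceColumn-off M c combination i k k≢c) (sym (replaceColumn-off M c w i k k≢c)))
    where combination = λ i → a * u i + b * w i

  det-dependent-columns : ∀ (M : Matrix n) k c₀ c₁ c₂ → k ≢ c₀ → k ≢ c₁ → k ≢ c₂ →
    (∀ i → M i k + M i c₀ ≡ M i c₁ + M i c₂) → det M ≡ + 0
  det-dependent-columns M k c₀ c₁ c₂ k≢c₀ k≢c₁ k≢c₂ relation = begin
    det M
      ≡⟨ det-replaceColumn M k _ col-k ⟩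
    det (replaceColumn M k (λ i → + 1 * col c₁ i + + 1 * difference i))
      ≡⟨ det-replaceColumn-linear M k (+ 1) (+ 1) (col c₁) difference ⟩
    + 1 * det (replaceColumn M k (col c₁)) + + 1 * det (replaceColumn M k difference)
      ≡⟨ cong₂ (λ x y → + 1 * x + + 1 * y) (det-copy-column M k c₁ k≢c₁)
               (trans (det-replaceColumn-linear M k (+ 1) (- + 1) (col c₂) (col c₀))
                      (cong₂ (λ x y → + 1 * x + - + 1 * y) (det-copy-column M k c₂ k≢c₂) (det-copy-column M k c₀ k≢c₀))) ⟩
    + 1 * + 0 + + 1 * (+ 1 * + 0 + - + 1 * + 0)
      ≡⟨⟩
    + 0 ∎
    where
    open ≡-Reasoning
    col : Fin _ → Fin _ → ℤ
    col c i = M i c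
    difference : Fin _ → ℤ
    difference i = + 1 * M i c₂ + - + 1 * M i c₀
    col-k : ∀ i → M i k ≡ + 1 * M i c₁ + + 1 * difference i
    col-k i = trans (isolate (M i k) (M i c₀) (M i c₁) (M i c₂) (relation i)) (regroup (M i c₀) (M i c₁) (M i c₂))
      where
      isolate : ∀ x y u w → x + y ≡ u + w → x ≡ u + w - y
      isolate x y u w eq = trans (cancel x y) (cong (_- y) eq)
        where cancel : ∀ x y → x ≡ x + y - y
              cancel = solve-∀
      regroup : ∀ y u w → u + w - y ≡ + 1 * u + + 1 * (+ 1 * w + - + 1 * y)
      regroup = solve-∀

  <?-step : ∀ c t → c ≢ t → does (c ℕ.<? suc t) ≡ does (c ℕ.<? t)
  <?-step c t c≢t with c ℕ.<? t
  ... | yes c<t = trans (dec-true (c ℕ.<? suc t) (ℕ.m<n⇒m<1+n c<t)) (sym (dec-true (c ℕ.<? t) c<t))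
  ... | no c≮t  = trans (dec-false (c ℕ.<? suc t) (λ c<t+1 → [ c≮t , c≢t ]′ (ℕ.m<1+n⇒m<n∨m≡n c<t+1)))
                        (sym (dec-false (c ℕ.<? t) c≮t))

  det-add-multiples : ∀ (M : Matrix n) k (a : Fin n → ℤ) → a k ≡ + 0 → det (λ i c → M i c + a c * M i k) ≡ det M
  det-add-multiples {n} M k a ak≡0 = trans (det-cong (λ i c → cong (λ x → M i c + x * M i k) (sym (mask-all c)))) (added-upto n)
    where
    -- Columns are updated one at a time: partial t has the columns before t updated.
    mask : ℕ → Fin n → ℤ
    mask t c = if does (toℕ c ℕ.<? t) then a c else + 0

    partial : ℕ → Matrix n
    partial t i c = M i c + mask t c * M i k

    mask-all : ∀ c → mask n c ≡ a c
    mask-all c rewrite dec-true (toℕ c ℕ.<? n) (toℕ<n c) = refl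

    mask-none : ∀ c → mask 0 c ≡ + 0
    mask-none c rewrite dec-false (toℕ c ℕ.<? 0) (λ ()) = refl

    mask-step : ∀ t c → toℕ c ≢ t → mask (suc t) c ≡ mask t c
    mask-step t c c≢t = cong (λ b → if b then a c else + 0) (<?-step (toℕ c) t c≢t)

    mask-k : ∀ t → mask t k ≡ + 0
    mask-k t with does (toℕ k ℕ.<? t)
    ... | true  = ak≡0
    ... | false = refl

    unmasked : ∀ t i c → mask t c ≡ + 0 → partial t i c ≡ M i c
    unmasked t i c m≡0 rewrite m≡0 = ℤ.+-identityʳ (M i c)

    next : ∀ t → det (partial (suc t)) ≡ det (partial t)
    next t with t ℕ.<? n
    ... | no t≮n =
      det-cong (λ i c → cong (λ x → M i c + x * M i k) (mask-step t c (λ c≡t → t≮n (subst (ℕ._< n) c≡t (toℕ<n c)))))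
    ... | yes t<n with fromℕ< t<n ≟ k
    ...   | yes refl = det-cong entry
      where
      entry : ∀ i c → partial (suc t) i c ≡ partial t i c
      entry i c with toℕ c ℕ.≟ t
      ... | yes c≡t rewrite toℕ-injective {i = c} {j = fromℕ< t<n} (trans c≡t (sym (toℕ-fromℕ< t<n))) =
            trans (unmasked (suc t) i _ (mask-k (suc t))) (sym (unmasked t i _ (mask-k t)))
      ... | no c≢t = cong (λ x → M i c + x * M i k) (mask-step t c c≢t)
    ...   | no ct≢k = det-add-column (partial t) (partial (suc t)) ct k (a ct) ct≢k column-t other-columns
      where
      ct = fromℕ< t<n
      t≡ct = sym (toℕ-fromℕ< t<n)
      column-t : ∀ i → partial (suc t) i ct ≡ partial t i ct + a ct * partial t i k
      column-t i rewrite unmasked t i k (mask-k t)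
                       | dec-true (toℕ ct ℕ.<? suc t) (subst (ℕ._< suc t) t≡ct (ℕ.n<1+n t))
                       | dec-false (toℕ ct ℕ.<? t) (subst (ℕ._≮ t) t≡ct (ℕ.n≮n t)) = absorb (M i ct) (a ct * M i k) (M i k)
        where absorb : ∀ x y z → x + y ≡ x + + 0 * z + y
              absorb = solve-∀
      other-columns : ∀ i j → j ≢ ct → partial (suc t) i j ≡ partial t i j
      other-columns i j j≢ct =
        cong (λ x → M i j + x * M i k) (mask-step t j (λ j≡t → j≢ct (toℕ-injective (trans j≡t t≡ct))))

    added-upto : ∀ t → det (partial t) ≡ det M
    added-upto zero    = det-cong (λ i c → unmasked 0 i c (mask-none c))
    added-upto (suc t) = trans (next t) (added-upto t)

open Determinant

module Book where

  open import Data.Nat as ℕ using (ℕ; zero; suc; z≤n; s≤s)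
  open import Data.Bool using (if_then_else_)
  open import Data.Integer as ℤ using (ℤ; +_; -[1+_]; _+_; _*_; -_)
  import Data.Integer.Properties as ℤ
  import Data.Nat.Properties as ℕ
  open import Data.Integer.Tactic.RingSolver using (solve-∀)
  open import Data.Fin using (Fin; toℕ; fromℕ<; _≟_) renaming (zero to fzero; suc to fsuc)
  open import Data.Fin.Properties using (toℕ<n; toℕ-injective)
  open import Data.Vec using (Vec)
  open import Data.Vec.Relation.Unary.All using (All; []; _∷_)
  open import Data.Vec.Relation.Unary.All.Properties using () renaming (lookup⁺ to All-lookup)
  open import Data.Product using (Σ-syntax; _×_; _,_; proj₁; proj₂)
  open import Relation.Binary.PropositionalEquality
  open import Relation.Nullary using (does; yes; no; contradiction)
  open import Relation.Nullary.Decidable using (dec-true; dec-false)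

  -- The distance matrix of C(1; 1, …, 1), a book of triangles on the spine u₀u₁; rows and
  -- columns are u₀, u₁ and then the ear vertices.
  bookDistance : ∀ {s} → Fin (suc (suc s)) → Fin (suc (suc s)) → ℕ
  bookDistance fzero           fzero           = 0
  bookDistance fzero           (fsuc _)        = 1
  bookDistance (fsuc fzero)    fzero           = 1
  bookDistance (fsuc fzero)    (fsuc fzero)    = 0
  bookDistance (fsuc fzero)    (fsuc (fsuc _)) = 1
  bookDistance (fsuc (fsuc _)) fzero           = 1
  bookDistance (fsuc (fsuc _)) (fsuc fzero)    = 1
  bookDistance (fsuc (fsuc i)) (fsuc (fsuc k)) = if does (i ≟ k) then 0 else 2

  -- Subtracting the columns of u₁ and u₀ from every ear column turns the matrix into
  -- S = [[0,1,0],[1,0,0],[1,1,−2I]].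
  det-book : ∀ s → det (λ x y → + bookDistance {s} x y) ≡ - (-[1+ 1 ] ℤ.^ s)
  det-book s = begin
    det B
      ≡⟨ sym (trans (det-add-multiples P fzero a refl) (det-add-multiples B hub₁ a refl)) ⟩
    det S
      ≡⟨ det-row₀ S hub₁ S-row₀ ⟩
    -[1+ 0 ] * (+ 1 * det (minor S hub₁))
      ≡⟨ cong (λ d → -[1+ 0 ] * (+ 1 * d)) (det-row₀ (minor S hub₁) fzero minor-row₀) ⟩
    -[1+ 0 ] * (+ 1 * (+ 1 * (+ 1 * det E)))
      ≡⟨ cong (λ d → -[1+ 0 ] * (+ 1 * (+ 1 * (+ 1 * d)))) (det-diagonal s E -[1+ 1 ] E-diagonal E-off) ⟩
    -[1+ 0 ] * (+ 1 * (+ 1 * (+ 1 * -[1+ 1 ] ℤ.^ s)))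
      ≡⟨ simplify (-[1+ 1 ] ℤ.^ s) ⟩
    - (-[1+ 1 ] ℤ.^ s) ∎
    where
    open ≡-Reasoning
    simplify : ∀ x → -[1+ 0 ] * (+ 1 * (+ 1 * (+ 1 * x))) ≡ - x
    simplify = solve-∀
    B : Matrix (suc (suc s))
    B x y = + bookDistance x y
    hub₁ : Fin (suc (suc s))
    hub₁ = fsuc fzero
    a : Fin (suc (suc s)) → ℤ
    a fzero           = + 0
    a (fsuc fzero)    = + 0
    a (fsuc (fsuc _)) = -[1+ 0 ]
    P S : Matrix (suc (suc s))
    P i c = B i c + a c * B i hub₁
    S i c = P i c + a c * P i fzero
    E : Matrix s
    E = minor (minor S hub₁) fzero
    S-row₀ : ∀ k → k ≢ hub₁ → S fzero k ≡ + 0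
    S-row₀ fzero           _      = refl
    S-row₀ (fsuc fzero)    k≢hub₁ = contradiction refl k≢hub₁
    S-row₀ (fsuc (fsuc k)) _      = refl
    minor-row₀ : ∀ k → k ≢ fzero → minor S hub₁ fzero k ≡ + 0
    minor-row₀ fzero    k≢0 = contradiction refl k≢0
    minor-row₀ (fsuc k) _   = refl
    E-diagonal : ∀ i → E i i ≡ -[1+ 1 ]
    E-diagonal i rewrite dec-true (i ≟ i) refl = refl
    E-off : ∀ i k → i ≢ k → E i k ≡ + 0
    E-off i k i≢k rewrite dec-false (i ≟ k) i≢k = refl

  module _ {r : ℕ} {ms : Vec ℕ r} (pos : All (1 ℕ.≤_) ms) (ones : All (_≡ 1) ms) where

    d-ones : ∀ j → d₁ ms (v j 1) ≡ 1 × d₀ ms (v j 1) ≡ 1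
    d-ones j rewrite All-lookup ones j = refl , refl

    ear-vertex : ∀ {ℓ x} → LabelOf ms ℓ x → 2 ℕ.≤ ℓ → Σ[ j ∈ Fin r ] x ≡ v j 1
    ear-vertex u₀         ()
    ear-vertex u₁         (s≤s ())
    ear-vertex (v j i i<) _ with ℕ.n<1⇒n≡0 (subst (i ℕ.<_) (All-lookup ones j) i<)
    ... | refl = j , refl

    earAt : ∀ (k : Fin (sumℕ ms)) → Σ[ j ∈ Fin r ] vertexOf ms (2 ℕ.+ toℕ k) ≡ v j 1 × LabelOf ms (2 ℕ.+ toℕ k) (v j 1)
    earAt k = let j , x≡ = ear-vertex ℓk (s≤s (s≤s z≤n)) in j , x≡ , subst (LabelOf ms (2 ℕ.+ toℕ k)) x≡ ℓk
      where
      ℓk : LabelOf ms (2 ℕ.+ toℕ k) (vertexOf ms (2 ℕ.+ toℕ k))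
      ℓk = labelOf ms (2 ℕ.+ toℕ k) (toℕ<n (fsuc (fsuc k)))

    distinct-ears : ∀ {k k′ : Fin (sumℕ ms)} {j j′} →
                    LabelOf ms (2 ℕ.+ toℕ k) (v j 1) → LabelOf ms (2 ℕ.+ toℕ k′) (v j′ 1) → k ≢ k′ → j ≢ j′
    distinct-ears ℓx ℓy k≢k′ refl = k≢k′ (toℕ-injective (ℕ.suc-injective (ℕ.suc-injective (labelOf-unique ms ℓx ℓy))))

    δ-book : ∀ (x y : Fin (Cverts 1 ms)) → δ ms (vertexOf ms (toℕ x)) (vertexOf ms (toℕ y)) ≡ bookDistance x y
    δ-book fzero           fzero           = refl
    δ-book fzero           (fsuc fzero)    = refl
    δ-book (fsuc fzero)    fzero           = refl
    δ-book (fsuc fzero)    (fsuc fzero)    = refl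
    δ-book fzero           (fsuc (fsuc k)) with earAt k
    ... | j , x≡ , _ rewrite x≡ | proj₁ (d-ones j) | proj₂ (d-ones j) = refl
    δ-book (fsuc fzero)    (fsuc (fsuc k)) with earAt k
    ... | j , x≡ , _ rewrite x≡ | proj₁ (d-ones j) = refl
    δ-book (fsuc (fsuc k)) fzero           with earAt k
    ... | j , x≡ , _ rewrite x≡ | proj₁ (d-ones j) | proj₂ (d-ones j) = refl
    δ-book (fsuc (fsuc k)) (fsuc fzero)    with earAt k
    ... | j , x≡ , _ rewrite x≡ | proj₁ (d-ones j) | proj₂ (d-ones j) = refl
    δ-book (fsuc (fsuc k)) (fsuc (fsuc k′)) with k ≟ k′
    ... | yes refl = δ-self ms (vertexOf ms (2 ℕ.+ toℕ k))
    ... | no k≢k′ with earAt k | earAt k′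
    ...   | j , x≡ , ℓx | j′ , y≡ , ℓy
      rewrite x≡ | y≡ | δ-otherEar ms 1 1 (distinct-ears ℓx ℓy k≢k′)
            | proj₁ (d-ones j) | proj₂ (d-ones j) | proj₁ (d-ones j′) | proj₂ (d-ones j′) = refl

    dist-allOnes : ∀ x y → dist (C 1 ms) x y ≡ bookDistance x y
    dist-allOnes x y = trans (dist-C≡δ ms pos x y) (δ-book x y)

  sumℕ-ones : ∀ {r} {ms : Vec ℕ r} → All (_≡ 1) ms → sumℕ ms ≡ r
  sumℕ-ones []            = refl
  sumℕ-ones (refl ∷ ones) = cong suc (sumℕ-ones ones)

  -[2]^-sign : ∀ k → - (-[1+ 1 ] ℤ.^ suc k) ≡ sgn k * + (2 ℕ.^ suc k)
  -[2]^-sign zero    = refl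
  -[2]^-sign (suc k) = begin
    - (-[1+ 1 ] ℤ.^ suc (suc k))         ≡⟨ push (-[1+ 1 ] ℤ.^ suc k) ⟩
    -[1+ 1 ] * - (-[1+ 1 ] ℤ.^ suc k)    ≡⟨ cong (-[1+ 1 ] *_) (-[2]^-sign k) ⟩
    -[1+ 1 ] * (sgn k * + (2 ℕ.^ suc k)) ≡⟨ regroup (sgn k) (+ (2 ℕ.^ suc k)) ⟩
    - sgn k * (+ 2 * + (2 ℕ.^ suc k))    ≡⟨ cong (- sgn k *_) (sym (ℤ.pos-* 2 (2 ℕ.^ suc k))) ⟩
    - sgn k * + (2 ℕ.^ suc (suc k))      ∎
    where
    open ≡-Reasoning
    push : ∀ x → - (-[1+ 1 ] * x) ≡ -[1+ 1 ] * - x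
    push = solve-∀
    regroup : ∀ s p → -[1+ 1 ] * (s * p) ≡ - s * (+ 2 * p)
    regroup = solve-∀

  det-allOnes : ∀ {k} {ms : Vec ℕ (suc k)} → All (1 ℕ.≤_) ms → All (_≡ 1) ms →
                det (distMatrix (C 1 ms)) ≡ sgn k * + (2 ℕ.^ suc k)
  det-allOnes {k} {ms} pos ones = begin
    det (distMatrix (C 1 ms))                   ≡⟨ det-cong (λ x y → cong +_ (dist-allOnes pos ones x y)) ⟩
    det (λ x y → + bookDistance {sumℕ ms} x y)  ≡⟨ det-book (sumℕ ms) ⟩
    - (-[1+ 1 ] ℤ.^ sumℕ ms)                    ≡⟨ cong (λ s → - (-[1+ 1 ] ℤ.^ s)) (sumℕ-ones ones) ⟩
    - (-[1+ 1 ] ℤ.^ suc k)                      ≡⟨ -[2]^-sign k ⟩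
    sgn k * + (2 ℕ.^ suc k)                     ∎
    where open ≡-Reasoning

open Book

module EvenEar where

  open import Data.Nat as ℕ using (ℕ; zero; suc; z≤n; s≤s)
  import Data.Nat.Properties as ℕ
  open import Data.Nat.Divisibility using (_∣_; divides)
  open import Data.Integer using (+_)
  import Data.Integer.Properties as ℤ
  open import Data.Fin using (Fin; toℕ; fromℕ<)
  open import Data.Fin.Properties using (toℕ<n; toℕ-fromℕ<)
  open import Data.Vec using (Vec)
  open import Data.Vec.Relation.Unary.All using (All)
  open import Data.Vec.Relation.Unary.All.Properties using () renaming (lookup⁺ to All-lookup)
  open import Data.Vec.Relation.Unary.Any using (Any; index)
  open import Data.Vec.Relation.Unary.Any.Properties using (lookup-index)
  open import Function using (_∘_)
  open import Relation.Binary.PropositionalEquality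
  open import Relation.Nullary using (contradiction)

  module _ {r : ℕ} (ms : Vec ℕ r) (pos : All (1 ℕ.≤_) ms) (j : Fin r) (g : ℕ) (M≡ : m ms j ≡ suc g ℕ.+ suc g) where

    private
      column : ∀ {ℓ} → ℓ ℕ.< Cverts 1 ms → Fin (Cverts 1 ms)
      column ℓ<N = fromℕ< ℓ<N

      dist-column : ∀ x {ℓ} (ℓ<N : ℓ ℕ.< Cverts 1 ms) →
                    dist (C 1 ms) x (column ℓ<N) ≡ δ ms (vertexOf ms (toℕ x)) (vertexOf ms ℓ)
      dist-column x ℓ<N =
        trans (dist-C≡δ ms pos x (column ℓ<N)) (cong (δ ms (vertexOf ms (toℕ x)) ∘ vertexOf ms) (toℕ-fromℕ< ℓ<N))

      column-≢ : ∀ {a b} (a<N : a ℕ.< Cverts 1 ms) (b<N : b ℕ.< Cverts 1 ms) → a ≢ b → column a<N ≢ column b<N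
      column-≢ a<N b<N a≢b eq = a≢b (trans (sym (toℕ-fromℕ< a<N)) (trans (cong toℕ eq) (toℕ-fromℕ< b<N)))

      g+1<m : suc g ℕ.< m ms j
      g+1<m = subst (suc g ℕ.<_) (sym M≡) (s≤s (ℕ.m≤n+m (suc g) g))
      g<m : g ℕ.< m ms j
      g<m = ℕ.<-trans (ℕ.n<1+n g) g+1<m

      v[g+2]<N = label<N ms pos j (suc g) g+1<m
      v[g+1]<N = label<N ms pos j g g<m
      u₀<N : 0 ℕ.< Cverts 1 ms
      u₀<N = s≤s z≤n
      u₁<N : 1 ℕ.< Cverts 1 ms
      u₁<N = s≤s (s≤s z≤n)

      columns-relation : ∀ x → dist (C 1 ms) x (column v[g+2]<N) ℕ.+ dist (C 1 ms) x (column u₁<N)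
                             ≡ dist (C 1 ms) x (column v[g+1]<N) ℕ.+ dist (C 1 ms) x (column u₀<N)
      columns-relation x
        rewrite dist-column x v[g+2]<N | dist-column x u₁<N | dist-column x v[g+1]<N | dist-column x u₀<N
              | vertexOf-label ms j (suc g) g+1<m | vertexOf-label ms j g g<m =
        balanced ms j M≡ (isVertex ms (labelOf ms (toℕ x) (toℕ<n x)))

    det-evenEar : det (distMatrix (C 1 ms)) ≡ + 0
    det-evenEar = det-dependent-columns (distMatrix (C 1 ms)) (column v[g+2]<N) (column u₁<N) (column v[g+1]<N) (column u₀<N)
      (column-≢ v[g+2]<N u₁<N λ ()) (column-≢ v[g+2]<N v[g+1]<N v[g+2]≢v[g+1]) (column-≢ v[g+2]<N u₀<N λ ())
      (λ x → trans (sym (ℤ.pos-+ (D x (column v[g+2]<N)) (D x (column u₁<N))))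
                   (trans (cong +_ (columns-relation x)) (ℤ.pos-+ (D x (column v[g+1]<N)) (D x (column u₀<N)))))
      where
      D = dist (C 1 ms)
      v[g+2]≢v[g+1] : label ms j (suc g) ≢ label ms j g
      v[g+2]≢v[g+1] eq = ℕ.1+n≢n (ℕ.+-cancelˡ-≡ (offset ms j) _ _ (ℕ.suc-injective (ℕ.suc-injective eq)))

  det-someEvenEar : ∀ {r} {ms : Vec ℕ r} → All (1 ℕ.≤_) ms → Any (2 ∣_) ms → det (distMatrix (C 1 ms)) ≡ + 0
  det-someEvenEar {ms = ms} pos even with lookup-index even | All-lookup pos (index even)
  ... | divides zero    m≡0 | m≥1 = contradiction (subst (1 ℕ.≤_) m≡0 m≥1) λ ()
  ... | divides (suc g) m≡  | _   = det-evenEar ms pos (index even) g (trans m≡ (double g))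
    where double : ∀ g → suc g ℕ.* 2 ≡ suc g ℕ.+ suc g
          double g = trans (ℕ.*-comm (suc g) 2) (cong (suc g ℕ.+_) (ℕ.+-identityʳ (suc g)))

open EvenEar

mainTheorem8 : (r : ℕ) → r ≥ 1 → (ms : Vec ℕ r) → All (λ m → m ≥ 1) ms →
    ((All (λ m → m ≡ 1) ms → det (distMatrix (C 1 ms)) ≡ sgn (r ∸ 1) * (+ (2 ^ r)))
    × (Any (λ m → 2 ∣ m) ms → det (distMatrix (C 1 ms)) ≡ + 0))
mainTheorem8 (suc k) _ ms pos = det-allOnes pos , det-someEvenEar pos
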